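{- Let $p$ be a prime, $q=p^k$, $d\ge1$, write $d+1=s(q-q/p)+r$ with $s$ divisible by $p$ and $0<r\le p(q-q/p)$, and let $t\ge1$. Then $\big|\bigcup_{e\in\{0,\dots,q-1\}^t}\mathrm{supp}(H_e)\big|\le(3q)^{\frac{d+1}{q}}q^t$; consequently the sparse $(s+t)$-flat test has query complexity at most $(3q)^{\frac{d+1}{q}}q^t$ (and, taking $t=p+2$, at most $(3q)^{\frac{d+1}{q}}q^{p+2}$).
   Context: $P(x_1,\dots,x_p)=\big(\sum_{I\subseteq[p-1]}(-1)^{|I|+1}(x_I+x_p)^{q-1}\big)/(x_1\cdots x_{p-1})$ (exact division), with $x_I=\sum_{i\in I}x_i$. For $e\in\{0,\dots,q-1\}^t$, $H_e(x_1,\dots,x_{s+t})=\prod_{i=1}^{s/p}P(x_{p(i-1)+1},\dots,x_{pi})\prod_{i=1}^t x_{s+i}^{e_i}$, and $\mathrm{supp}(H_e)=\{x\in\mathbb{F}_q^{s+t}:H_e(x)\ne0\}$. The sparse $(s+t)$-flat test picks a random affine map $T\colon\mathbb{F}_q^{s+t}\to\mathbb{F}_q^n$ and checks $\langle f\circ T,H_e\rangle=\sum_{v}f(T(v))H_e(v)=0$ for all $e$ with $\sum e_i\le t(q-1)-r$; it only queries $f$ at $T(v)$ for $v$ in the union of the supports. -}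

module Defs where

open import Level using (Level; _⊔_) renaming (suc to lsuc)
open import Algebra.Bundles using (CommutativeRing)
open import Data.Bool using (Bool; true; false; not; if_then_else_)
open import Data.Nat as ℕ using (ℕ; zero; suc; _∸_)
open import Data.Fin using (Fin; toℕ; inject₁; fromℕ)
open import Data.Vec as V using (Vec; []; _∷_)
open import Data.Vec.Properties using (≡-dec)
open import Data.List as L using (List; []; _∷_; upTo; allFin; concatMap; filterᵇ; length)
open import Data.Bool.ListAction using (any)
open import Data.Product using (∃)
open import Relation.Nullary using (¬_; does)
open import Relation.Binary using (Decidable)
open import Relation.Binary.PropositionalEquality using (_≡_)

record FiniteField (c ℓ : Level) (q : ℕ) : Set (lsuc (c ⊔ ℓ)) where
  field
    commRing : CommutativeRing c ℓ
  open CommutativeRing commRing public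
  field
    _≟_             : Decidable _≈_
    1≉0             : ¬ (1# ≈ 0#)
    inverse         : ∀ x → ¬ (x ≈ 0#) → ∃ λ y → x * y ≈ 1#
    enum            : Fin q → Carrier
    enum-injective  : ∀ i j → enum i ≈ enum j → i ≡ j
    enum-surjective : ∀ x → ∃ λ i → enum i ≈ x

allVecs : ∀ {a} {A : Set a} → List A → ∀ n → List (Vec A n)
allVecs xs zero    = [] ∷ []
allVecs xs (suc n) = concatMap (λ x → L.map (x ∷_) (allVecs xs n)) xs

below : ∀ {n} → Vec ℕ n → List (Vec ℕ n)
below []       = [] ∷ []
below (b ∷ bs) = concatMap (λ i → L.map (i ∷_) (below bs)) (upTo (suc b))

subsets : ∀ m → List (Vec Bool m)
subsets m = allVecs (false ∷ true ∷ []) m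

card : ∀ {m} → Vec Bool m → ℕ
card []           = 0
card (true ∷ bs)  = suc (card bs)
card (false ∷ bs) = card bs

unitVec : ∀ {n} → Fin n → Vec ℕ n
unitVec i = V.updateAt (V.replicate _ 0) i (λ _ → 1)

bump : ∀ {m} → Vec ℕ (suc m) → Vec ℕ (suc m)
bump {zero}  (x ∷ [])     = x ∷ []
bump {suc m} (x ∷ y ∷ xs) = suc x ∷ bump (y ∷ xs)

even : ℕ → Bool
even zero          = true
even (suc zero)    = false
even (suc (suc n)) = even n

nth : ∀ {a} {A : Set a} {n} → A → Vec A n → ℕ → A
nth d []       _       = d
nth d (x ∷ xs) zero    = x
nth d (x ∷ xs) (suc i) = nth d xs i

-- Polynomials over F, represented by their coefficient functions

module Construction {c ℓ q} (F : FiniteField c ℓ q) where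
  open FiniteField F

  Poly : ℕ → Set c
  Poly n = Vec ℕ n → Carrier

  Σ : ∀ {a} {A : Set a} → List A → (A → Carrier) → Carrier
  Σ xs f = L.foldr (λ x acc → f x + acc) 0# xs

  pow : Carrier → ℕ → Carrier
  pow x zero    = 1#
  pow x (suc n) = x * pow x n

  isZeroVec : ∀ {n} → Vec ℕ n → Bool
  isZeroVec a = does (≡-dec ℕ._≟_ a (V.replicate _ 0))

  constP : ∀ {n} → Carrier → Poly n
  constP r a = if isZeroVec a then r else 0#

  varP : ∀ {n} → Fin n → Poly n
  varP i a = if does (≡-dec ℕ._≟_ a (unitVec i)) then 1# else 0#

  _⊕_ : ∀ {n} → Poly n → Poly n → Poly n
  (f ⊕ g) a = f a + g a

  scaleP : ∀ {n} → Carrier → Poly n → Poly n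
  scaleP r f a = r * f a

  _⊛_ : ∀ {n} → Poly n → Poly n → Poly n
  (f ⊛ g) cc = Σ (below cc) (λ a → f a * g (V.zipWith _∸_ cc a))

  _^P_ : ∀ {n} → Poly n → ℕ → Poly n
  f ^P zero  = constP 1#
  f ^P suc m = f ⊛ (f ^P m)

  evalP : ∀ {n} → ℕ → Poly n → Vec Carrier n → Carrier
  evalP {n} D f x =
    Σ (below (V.replicate n D))
      (λ a → f a * V.foldr _ _*_ 1# (V.zipWith pow x a))

  sign : ℕ → Carrier
  sign n = if even n then 1# else - 1#

  -- variables x_1..x_m are inject₁ i, x_p (p = m+1) is fromℕ m
  -- x_I + x_p
  linForm : ∀ {m} → Vec Bool m → Poly (suc m)
  linForm {m} I =
    L.foldr _⊕_ (varP (fromℕ m))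
      (L.map (λ i → if V.lookup I i then varP (inject₁ i) else constP 0#) (allFin m))

  numer : ∀ m → Poly (suc m)
  numer m = L.foldr _⊕_ (constP 0#)
    (L.map (λ I → scaleP (sign (suc (card I))) (linForm I ^P (q ∸ 1))) (subsets m))

  -- P = numer / (x_1 ⋯ x_{p-1})  (exact division: shift exponents)
  Ppoly : ∀ m → Poly (suc m)
  Ppoly m a = numer m (bump a)

  -- value of P(x_1,…,x_p) (p ≥ 1; p = 0 never occurs since p is prime)
  Pval : ∀ p → Vec Carrier p → Carrier
  Pval zero    x = 0#
  Pval (suc m) x = evalP q (Ppoly m) x

  H : (p s t : ℕ) → Vec (Fin q) t → Vec Carrier (s ℕ.+ t) → Carrier
  H p s t e x =
    L.foldr _*_ 1#
      (L.map (λ i → Pval p (V.tabulate (λ j → at (p ℕ.* i ℕ.+ toℕ j))))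
             (upTo (s ℕ./ suc (p ∸ 1))))
    * L.foldr _*_ 1#
      (L.map (λ i → pow (at (s ℕ.+ toℕ i)) (toℕ (V.lookup e i))) (allFin t))
    where at = nth 0# x

  nonzero : Carrier → Bool
  nonzero y = not (does (y ≟ 0#))

  unionSize : (p s t : ℕ) → ℕ
  unionSize p s t =
    length (filterᵇ
      (λ idx → any (λ e → nonzero (H p s t e (V.map enum idx)))
                   (allVecs (allFin q) t))
      (allVecs (allFin q) (s ℕ.+ t)))

-- If x₁, …, x_{p-1} are nonzero and no linear form x_I + x_p vanishes, Fermat's little
-- theorem turns P(x)·x₁⋯x_{p-1} = Σ_I (-1)^{|I|+1} (x_I + x_p)^{q-1} into Σ_I (-1)^{|I|+1} = 0.
-- So supp P lies in the union of the p-1 hyperplanes x_i = 0 and the 2^{p-1} hyperplanes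
-- x_I + x_p = 0, whence |supp P| ≤ (p-1 + 2^{p-1}) q^{p-1} ≤ (3q)^{p-1}. Every H_e has the
-- factor ∏_i P(i-th block of p variables), so the union of the supports lies in
-- (supp P)^{s/p} × F^t and has at most (3q)^{(p-1)s/p} q^t points; raising this to the
-- q-th power gives the exponent (p-1)(s/p) q = s(q - q/p) ≤ d + 1.
module Submission where

open import Defs
open import Level using (Level)
open import Algebra.Bundles using (Semiring)
open import Data.Bool using (Bool; true; false; not; if_then_else_; _∧_; _∨_)
open import Data.Bool.ListAction using (any; all)
import Data.Bool.Properties as Boolₚ
open import Data.Empty using (⊥-elim)
open import Data.Fin as Fin using (Fin; toℕ; inject₁; fromℕ)
import Data.Fin.Properties as Finₚ
open import Data.List as L using (List; []; _∷_; upTo; allFin; applyUpTo; concatMap; _++_; length; filterᵇ)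
import Data.List.Properties as Lₚ
open import Data.Nat as ℕ using (ℕ; zero; suc; _∸_; _≤_; _<_; z≤n; s≤s)
import Data.Nat.Properties as ℕₚ
import Data.Nat.DivMod as DivMod
open import Data.Product using (∃; _,_; proj₁; proj₂; _×_)
open import Data.Sum using (_⊎_; inj₁; inj₂)
open import Data.Vec as V using (Vec; []; _∷_)
open import Data.Vec.Properties using (≡-dec)
import Data.Vec.Properties as Vₚ
open import Function using (_∘_; id)
open import Function.Bundles using (Equivalence)
import Data.List.Relation.Unary.Any as Any
import Data.List.Relation.Unary.Any.Properties as Anyₚ
open import Relation.Nullary using (¬_; does; yes; no)
open import Relation.Binary.PropositionalEquality as ≡ using (_≡_; _≢_)

anyInit : ∀ {a} {A : Set a} {m} → (A → Bool) → Vec A (suc m) → Bool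
anyInit {m = zero}  P (_ ∷ [])     = false
anyInit {m = suc m} P (x ∷ y ∷ xs) = P x ∨ anyInit P (y ∷ xs)

anyInit-map : ∀ {a b} {A : Set a} {B : Set b} {m} (R : B → Bool) (f : A → B) (w : Vec A (suc m)) →
  anyInit R (V.map f w) ≡ anyInit (R ∘ f) w
anyInit-map {m = zero}  R f (_ ∷ [])     = ≡.refl
anyInit-map {m = suc m} R f (x ∷ y ∷ w) = ≡.cong (R (f x) ∨_) (anyInit-map R f (y ∷ w))

module _ {a} {A : Set a} (d : A) where

  nth-++ˡ : ∀ {m n} (y : Vec A m) (z : Vec A n) k → k < m → nth d (y V.++ z) k ≡ nth d y k
  nth-++ˡ (x ∷ y) z zero    _         = ≡.refl
  nth-++ˡ (x ∷ y) z (suc k) (s≤s k<m) = nth-++ˡ y z k k<m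

  nth-++ʳ : ∀ {m n} (y : Vec A m) (z : Vec A n) k → nth d (y V.++ z) (m ℕ.+ k) ≡ nth d z k
  nth-++ʳ []      z k = ≡.refl
  nth-++ʳ (x ∷ y) z k = nth-++ʳ y z k

  nth-toℕ : ∀ {n} (y : Vec A n) (j : Fin n) → nth d y (toℕ j) ≡ V.lookup y j
  nth-toℕ (x ∷ y) Fin.zero    = ≡.refl
  nth-toℕ (x ∷ y) (Fin.suc j) = nth-toℕ y j

map-∷ʳ : ∀ {a b} {A : Set a} {B : Set b} {m} (f : A → B) (u : Vec A m) y → V.map f (u V.∷ʳ y) ≡ V.map f u V.∷ʳ f y
map-∷ʳ f []      y = ≡.refl
map-∷ʳ f (x ∷ u) y = ≡.cong (f x ∷_) (map-∷ʳ f u y)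

lookup-∷ʳ-inject₁ : ∀ {a} {A : Set a} {m} (u : Vec A m) y (i : Fin m) → V.lookup (u V.∷ʳ y) (inject₁ i) ≡ V.lookup u i
lookup-∷ʳ-inject₁ (_ ∷ u) y Fin.zero    = ≡.refl
lookup-∷ʳ-inject₁ (_ ∷ u) y (Fin.suc i) = lookup-∷ʳ-inject₁ u y i

lookup-∷ʳ-last : ∀ {a} {A : Set a} {m} (u : Vec A m) y → V.lookup (u V.∷ʳ y) (fromℕ m) ≡ y
lookup-∷ʳ-last []      y = ≡.refl
lookup-∷ʳ-last (_ ∷ u) y = lookup-∷ʳ-last u y

all-applyUpTo-cong : ∀ n (h h′ : ℕ → ℕ) (f f′ : ℕ → Bool) → (∀ i → i < n → f (h i) ≡ f′ (h′ i)) →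
  all f (applyUpTo h n) ≡ all f′ (applyUpTo h′ n)
all-applyUpTo-cong zero    h h′ f f′ f≡f′ = ≡.refl
all-applyUpTo-cong (suc n) h h′ f f′ f≡f′ = ≡.cong₂ _∧_ (f≡f′ 0 (s≤s z≤n))
  (all-applyUpTo-cong n (h ∘ suc) (h′ ∘ suc) f f′ (λ i i<n → f≡f′ (suc i) (s≤s i<n)))

module Blocks {a} {A : Set a} (d : A) (p : ℕ) where

  blockAt : ∀ {n} → Vec A n → ℕ → Vec A p
  blockAt y i = V.tabulate (λ j → nth d y (p ℕ.* i ℕ.+ toℕ j))

  allBlocks : (Vec A p → Bool) → ℕ → ∀ {n} → Vec A n → Bool
  allBlocks P B y = all (λ i → P (blockAt y i)) (upTo B)

  block-index< : ∀ B i (j : Fin p) → i < B → p ℕ.* i ℕ.+ toℕ j < B ℕ.* p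
  block-index< B i j i<B = begin-strict
    p ℕ.* i ℕ.+ toℕ j  <⟨ ℕₚ.+-monoʳ-< (p ℕ.* i) (Finₚ.toℕ<n j) ⟩
    p ℕ.* i ℕ.+ p      ≡⟨ ℕₚ.+-comm (p ℕ.* i) p ⟩
    p ℕ.+ p ℕ.* i      ≡⟨ ℕₚ.*-suc p i ⟨
    p ℕ.* suc i        ≤⟨ ℕₚ.*-monoʳ-≤ p i<B ⟩
    p ℕ.* B            ≡⟨ ℕₚ.*-comm p B ⟩
    B ℕ.* p            ∎
    where open ℕₚ.≤-Reasoning

  blockAt-++ˡ : ∀ B {n} (y : Vec A (B ℕ.* p)) (z : Vec A n) i → i < B → blockAt (y V.++ z) i ≡ blockAt y i
  blockAt-++ˡ B y z i i<B = Vₚ.tabulate-cong (λ j → nth-++ˡ d y z _ (block-index< B i j i<B))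

  blockAt-++-zero : ∀ {n} (w : Vec A p) (r : Vec A n) → blockAt (w V.++ r) 0 ≡ w
  blockAt-++-zero w r = ≡.trans (Vₚ.tabulate-cong (λ j →
      ≡.trans (≡.cong (λ k → nth d (w V.++ r) (k ℕ.+ toℕ j)) (ℕₚ.*-zeroʳ p))
              (≡.trans (nth-++ˡ d w r (toℕ j) (Finₚ.toℕ<n j)) (nth-toℕ d w j))))
    (Vₚ.tabulate∘lookup w)

  blockAt-++-suc : ∀ {n} (w : Vec A p) (r : Vec A n) i → blockAt (w V.++ r) (suc i) ≡ blockAt r i
  blockAt-++-suc w r i = Vₚ.tabulate-cong (λ j →
    ≡.trans (≡.cong (nth d (w V.++ r)) (≡.trans (≡.cong (ℕ._+ toℕ j) (ℕₚ.*-suc p i)) (ℕₚ.+-assoc p (p ℕ.* i) (toℕ j))))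
            (nth-++ʳ d w r (p ℕ.* i ℕ.+ toℕ j)))

  allBlocks-++ˡ : ∀ P B {n} (y : Vec A (B ℕ.* p)) (z : Vec A n) → allBlocks P B (y V.++ z) ≡ allBlocks P B y
  allBlocks-++ˡ P B y z = all-applyUpTo-cong B id id _ _ (λ i i<B → ≡.cong P (blockAt-++ˡ B y z i i<B))

  allBlocks-++ : ∀ P B {n} (w : Vec A p) (r : Vec A n) → allBlocks P (suc B) (w V.++ r) ≡ P w ∧ allBlocks P B r
  allBlocks-++ P B w r = ≡.cong₂ _∧_ (≡.cong P (blockAt-++-zero w r))
    (all-applyUpTo-cong B suc id _ _ (λ i _ → ≡.cong P (blockAt-++-suc w r i)))

module ListSum {c ℓ} (S : Semiring c ℓ) where
  open Semiring S
  open import Algebra.Properties.CommutativeSemigroup +-commutativeSemigroup using (interchange)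
  open import Relation.Binary.Reasoning.Setoid setoid

  sumFrom : ∀ {a} {A : Set a} → List A → (A → Carrier) → Carrier → Carrier
  sumFrom xs f z = L.foldr (λ x acc → f x + acc) z xs

  ∑ : ∀ {a} {A : Set a} → List A → (A → Carrier) → Carrier
  ∑ xs f = sumFrom xs f 0#

  module _ {a} {A : Set a} where

    sumFrom-cong : ∀ (xs : List A) {f g : A → Carrier} {z z′} →
      (∀ x → f x ≈ g x) → z ≈ z′ → sumFrom xs f z ≈ sumFrom xs g z′
    sumFrom-cong []       f≈g z≈z′ = z≈z′
    sumFrom-cong (x ∷ xs) f≈g z≈z′ = +-cong (f≈g x) (sumFrom-cong xs f≈g z≈z′)

    sumFrom-zero : ∀ (xs : List A) {f : A → Carrier} {z} →
      (∀ x → f x ≈ 0#) → z ≈ 0# → sumFrom xs f z ≈ 0#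
    sumFrom-zero []       f≈0 z≈0 = z≈0
    sumFrom-zero (x ∷ xs) f≈0 z≈0 = trans (+-cong (f≈0 x) (sumFrom-zero xs f≈0 z≈0)) (+-identityˡ _)

    sumFrom-*ʳ : ∀ (xs : List A) (f : A → Carrier) z y →
      sumFrom xs (λ x → f x * y) (z * y) ≈ sumFrom xs f z * y
    sumFrom-*ʳ []       f z y = refl
    sumFrom-*ʳ (x ∷ xs) f z y = trans (+-congˡ (sumFrom-*ʳ xs f z y)) (sym (distribʳ y _ _))

    sumFrom-split : ∀ (xs : List A) (f : A → Carrier) z → sumFrom xs f z ≈ ∑ xs f + z
    sumFrom-split []       f z = sym (+-identityˡ z)
    sumFrom-split (x ∷ xs) f z = trans (+-congˡ (sumFrom-split xs f z)) (sym (+-assoc _ _ _))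

    ∑-cong : ∀ (xs : List A) {f g : A → Carrier} → (∀ x → f x ≈ g x) → ∑ xs f ≈ ∑ xs g
    ∑-cong xs f≈g = sumFrom-cong xs f≈g refl

    ∑-zero : ∀ (xs : List A) {f : A → Carrier} → (∀ x → f x ≈ 0#) → ∑ xs f ≈ 0#
    ∑-zero xs f≈0 = sumFrom-zero xs f≈0 refl

    ∑-cong-¬any : ∀ (xs : List A) (P : A → Bool) {f g : A → Carrier} → any P xs ≡ false →
      (∀ x → P x ≡ false → f x ≈ g x) → ∑ xs f ≈ ∑ xs g
    ∑-cong-¬any []       P ¬any f≈g = refl
    ∑-cong-¬any (x ∷ xs) P ¬any f≈g = +-cong (f≈g x (Boolₚ.∨-conicalˡ _ _ ¬any))
                                             (∑-cong-¬any xs P (Boolₚ.∨-conicalʳ (P x) _ ¬any) f≈g)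

    ∑-++ : ∀ (xs ys : List A) (f : A → Carrier) → ∑ (xs ++ ys) f ≈ ∑ xs f + ∑ ys f
    ∑-++ xs ys f = trans (reflexive (Lₚ.foldr-++ _ 0# xs ys)) (sumFrom-split xs f (∑ ys f))

    ∑-distrib-+ : ∀ (xs : List A) (f g : A → Carrier) → ∑ xs (λ x → f x + g x) ≈ ∑ xs f + ∑ xs g
    ∑-distrib-+ []       f g = sym (+-identityˡ _)
    ∑-distrib-+ (x ∷ xs) f g = trans (+-congˡ (∑-distrib-+ xs f g)) (interchange _ _ _ _)

    ∑-*ˡ : ∀ (xs : List A) (f : A → Carrier) y → ∑ xs (λ x → y * f x) ≈ y * ∑ xs f
    ∑-*ˡ []       f y = sym (zeroʳ y)
    ∑-*ˡ (x ∷ xs) f y = trans (+-congˡ (∑-*ˡ xs f y)) (sym (distribˡ y _ _))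

    ∑-*ʳ : ∀ (xs : List A) (f : A → Carrier) y → ∑ xs (λ x → f x * y) ≈ ∑ xs f * y
    ∑-*ʳ xs f y = trans (sumFrom-cong xs (λ _ → refl) (sym (zeroˡ y))) (sumFrom-*ʳ xs f 0# y)

  module _ {a b} {A : Set a} {B : Set b} where

    ∑-map : ∀ (xs : List A) (h : A → B) (f : B → Carrier) → ∑ (L.map h xs) f ≡ ∑ xs (f ∘ h)
    ∑-map []       h f = ≡.refl
    ∑-map (x ∷ xs) h f = ≡.cong (f (h x) +_) (∑-map xs h f)

    ∑-concatMap : ∀ (xs : List A) (g : A → List B) (f : B → Carrier) →
      ∑ (concatMap g xs) f ≈ ∑ xs (λ x → ∑ (g x) f)
    ∑-concatMap []       g f = refl
    ∑-concatMap (x ∷ xs) g f = trans (∑-++ (g x) (concatMap g xs) f) (+-congˡ (∑-concatMap xs g f))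

  ∑-applyUpTo : ∀ n (h : ℕ → ℕ) (f : ℕ → Carrier) → ∑ (applyUpTo h n) f ≡ ∑ (upTo n) (f ∘ h)
  ∑-applyUpTo n h f = ≡.trans (≡.cong (λ xs → ∑ xs f) (≡.sym (Lₚ.map-upTo h n))) (∑-map (upTo n) h f)

  ∑-subsets-suc : ∀ m (f : Vec Bool (suc m) → Carrier) →
    ∑ (subsets (suc m)) f ≈ ∑ (subsets m) (λ I → f (false ∷ I)) + ∑ (subsets m) (λ I → f (true ∷ I))
  ∑-subsets-suc m f = trans (∑-concatMap (false ∷ true ∷ []) (λ b → L.map (b ∷_) (subsets m)) f)
    (+-cong (reflexive (∑-map (subsets m) (false ∷_) f))
            (trans (+-identityʳ _) (reflexive (∑-map (subsets m) (true ∷_) f))))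

  ∑-subsets-pairing : ∀ m (i : Fin m) (f : Vec Bool m → Carrier) →
    (∀ I → f (V.updateAt I i (λ _ → false)) + f (V.updateAt I i (λ _ → true)) ≈ 0#) →
    ∑ (subsets m) f ≈ 0#
  ∑-subsets-pairing (suc m) Fin.zero f cancel = begin
    ∑ (subsets (suc m)) f                                                   ≈⟨ ∑-subsets-suc m f ⟩
    ∑ (subsets m) (λ I → f (false ∷ I)) + ∑ (subsets m) (λ I → f (true ∷ I)) ≈⟨ ∑-distrib-+ (subsets m) _ _ ⟨
    ∑ (subsets m) (λ I → f (false ∷ I) + f (true ∷ I))                      ≈⟨ ∑-zero (subsets m) (λ I → cancel (false ∷ I)) ⟩
    0#                                                                      ∎
  ∑-subsets-pairing (suc m) (Fin.suc i) f cancel = begin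
    ∑ (subsets (suc m)) f                                                   ≈⟨ ∑-subsets-suc m f ⟩
    ∑ (subsets m) (λ I → f (false ∷ I)) + ∑ (subsets m) (λ I → f (true ∷ I)) ≈⟨ +-cong
        (∑-subsets-pairing m i (λ I → f (false ∷ I)) (λ I → cancel (false ∷ I)))
        (∑-subsets-pairing m i (λ I → f (true ∷ I)) (λ I → cancel (true ∷ I))) ⟩
    0# + 0#                                                                 ≈⟨ +-identityˡ 0# ⟩
    0#                                                                      ∎

  ∑-upTo-shift : ∀ D (h : ℕ → Carrier) → h 0 ≈ 0# → h (suc D) ≈ 0# →
    ∑ (upTo (suc D)) (h ∘ suc) ≈ ∑ (upTo (suc D)) h
  ∑-upTo-shift D h h0≈0 hD≈0 = begin
    ∑ (upTo (suc D)) (h ∘ suc)               ≡⟨ ∑-applyUpTo (suc D) suc h ⟨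
    ∑ (applyUpTo suc (suc D)) h              ≡⟨ ≡.cong (λ xs → ∑ xs h) (≡.sym (Lₚ.applyUpTo-∷ʳ suc D)) ⟩
    ∑ (applyUpTo suc D L.∷ʳ suc D) h         ≈⟨ ∑-++ (applyUpTo suc D) _ h ⟩
    ∑ (applyUpTo suc D) h + (h (suc D) + 0#) ≈⟨ +-congˡ (trans (+-identityʳ _) hD≈0) ⟩
    ∑ (applyUpTo suc D) h + 0#               ≈⟨ +-identityʳ _ ⟩
    ∑ (applyUpTo suc D) h                    ≈⟨ sym (+-identityˡ _) ⟩
    0# + ∑ (applyUpTo suc D) h               ≈⟨ +-congʳ (sym h0≈0) ⟩
    ∑ (upTo (suc D)) h                       ∎

module PolyEvaluation {c ℓ q} (F : FiniteField c ℓ q) where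
  open FiniteField F
  open Construction F
  open ListSum semiring
  open import Algebra.Properties.CommutativeSemigroup *-commutativeSemigroup using (x∙yz≈y∙xz; interchange)
  open import Relation.Binary.Reasoning.Setoid setoid

  monomial : ∀ {n} → Vec Carrier n → Vec ℕ n → Carrier
  monomial x a = V.foldr (λ _ → Carrier) _*_ 1# (V.zipWith pow x a)

  ∑-below-∷ : ∀ {n} b (bs : Vec ℕ n) (f : Vec ℕ (suc n) → Carrier) →
    ∑ (below (b ∷ bs)) f ≈ ∑ (upTo (suc b)) (λ i → ∑ (below bs) (λ a → f (i ∷ a)))
  ∑-below-∷ b bs f = trans (∑-concatMap (upTo (suc b)) (λ i → L.map (i ∷_) (below bs)) f)
    (∑-cong (upTo (suc b)) (λ i → reflexive (∑-map (below bs) (i ∷_) f)))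

  incAt : ∀ {n} → Fin n → Vec ℕ n → Vec ℕ n
  incAt Fin.zero    (a ∷ as) = suc a ∷ as
  incAt (Fin.suc j) (a ∷ as) = a ∷ incAt j as

  ∑-below-incAt : ∀ {n} (j : Fin n) D (G : Vec ℕ n → Carrier) →
    (∀ b → V.lookup b j ≡ 0 → G b ≈ 0#) → (∀ b → V.lookup b j ≡ suc D → G b ≈ 0#) →
    ∑ (below (V.replicate n D)) (G ∘ incAt j) ≈ ∑ (below (V.replicate n D)) G
  ∑-below-incAt {suc n} Fin.zero D G vanish₀ vanish₁ = begin
    ∑ (below (D ∷ rep)) (G ∘ incAt Fin.zero)  ≈⟨ ∑-below-∷ D rep _ ⟩
    ∑ (upTo (suc D)) (slice ∘ suc)            ≈⟨ ∑-upTo-shift D slice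
                                                   (∑-zero (below rep) (λ a → vanish₀ (0 ∷ a) ≡.refl))
                                                   (∑-zero (below rep) (λ a → vanish₁ (suc D ∷ a) ≡.refl)) ⟩
    ∑ (upTo (suc D)) slice                    ≈⟨ ∑-below-∷ D rep G ⟨
    ∑ (below (D ∷ rep)) G                     ∎
    where
    rep : Vec ℕ n
    rep = V.replicate n D
    slice : ℕ → Carrier
    slice i = ∑ (below rep) (λ a → G (i ∷ a))
  ∑-below-incAt {suc n} (Fin.suc j) D G vanish₀ vanish₁ = begin
    ∑ (below (D ∷ rep)) (G ∘ incAt (Fin.suc j))                       ≈⟨ ∑-below-∷ D rep _ ⟩
    ∑ (upTo (suc D)) (λ i → ∑ (below rep) (λ a → G (i ∷ incAt j a)))  ≈⟨ ∑-cong (upTo (suc D)) (λ i →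
        ∑-below-incAt j D (λ a → G (i ∷ a)) (λ b → vanish₀ (i ∷ b)) (λ b → vanish₁ (i ∷ b))) ⟩
    ∑ (upTo (suc D)) (λ i → ∑ (below rep) (λ a → G (i ∷ a)))          ≈⟨ ∑-below-∷ D rep G ⟨
    ∑ (below (D ∷ rep)) G                                             ∎
    where
    rep : Vec ℕ n
    rep = V.replicate n D

  ∑-below-bump : ∀ m D (G : Vec ℕ (suc m) → Carrier) →
    (∀ b (i : Fin m) → V.lookup b (inject₁ i) ≡ 0 → G b ≈ 0#) →
    (∀ b (i : Fin m) → V.lookup b (inject₁ i) ≡ suc D → G b ≈ 0#) →
    ∑ (below (V.replicate (suc m) D)) (G ∘ bump) ≈ ∑ (below (V.replicate (suc m) D)) G
  ∑-below-bump zero    D G vanish₀ vanish₁ = ∑-cong (below (D ∷ [])) (λ { (_ ∷ []) → refl })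
  ∑-below-bump (suc m) D G vanish₀ vanish₁ = begin
    ∑ (below (D ∷ rep)) (G ∘ bump)                                     ≈⟨ ∑-below-∷ D rep _ ⟩
    ∑ (upTo (suc D)) (λ i → ∑ (below rep) (λ a → G (bump (i ∷ a))))   ≈⟨ ∑-cong (upTo (suc D)) (λ i →
        trans (∑-cong (below rep) (λ a → reflexive (≡.cong G (bump-∷ i a))))
              (∑-below-bump m D (λ a → G (suc i ∷ a))
                 (λ b j → vanish₀ (suc i ∷ b) (Fin.suc j)) (λ b j → vanish₁ (suc i ∷ b) (Fin.suc j)))) ⟩
    ∑ (upTo (suc D)) (λ i → ∑ (below rep) (λ a → G (suc i ∷ a)))      ≈⟨ ∑-below-∷ D rep _ ⟨
    ∑ (below (D ∷ rep)) (G ∘ incAt Fin.zero)                           ≈⟨ ∑-below-incAt Fin.zero D G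
                                                                            (λ b → vanish₀ b Fin.zero) (λ b → vanish₁ b Fin.zero) ⟩
    ∑ (below (D ∷ rep)) G                                              ∎
    where
    rep : Vec ℕ (suc m)
    rep = V.replicate (suc m) D
    bump-∷ : ∀ i (a : Vec ℕ (suc m)) → bump (i ∷ a) ≡ suc i ∷ bump a
    bump-∷ i (_ ∷ _) = ≡.refl

  initProduct : ∀ {m} → Vec Carrier (suc m) → Carrier
  initProduct {zero}  (_ ∷ [])     = 1#
  initProduct {suc m} (x ∷ y ∷ xs) = x * initProduct (y ∷ xs)

  monomial-incAt : ∀ {n} (j : Fin n) x a → monomial x (incAt j a) ≈ V.lookup x j * monomial x a
  monomial-incAt Fin.zero    (x ∷ xs) (a ∷ as) = *-assoc _ _ _
  monomial-incAt (Fin.suc j) (x ∷ xs) (a ∷ as) =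
    trans (*-congˡ (monomial-incAt j xs as)) (x∙yz≈y∙xz _ _ _)

  monomial-bump : ∀ {m} x (a : Vec ℕ (suc m)) → monomial x (bump a) ≈ monomial x a * initProduct x
  monomial-bump {zero}  (x ∷ [])     (a ∷ [])     = sym (*-identityʳ _)
  monomial-bump {suc m} (x ∷ y ∷ xs) (a ∷ b ∷ as) = begin
    (x * pow x a) * monomial (y ∷ xs) (bump (b ∷ as))             ≈⟨ *-congˡ (monomial-bump (y ∷ xs) (b ∷ as)) ⟩
    (x * pow x a) * (monomial (y ∷ xs) (b ∷ as) * initProduct (y ∷ xs)) ≈⟨ *-congʳ (*-comm x _) ⟩
    (pow x a * x) * (monomial (y ∷ xs) (b ∷ as) * initProduct (y ∷ xs)) ≈⟨ interchange _ _ _ _ ⟩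
    (pow x a * monomial (y ∷ xs) (b ∷ as)) * (x * initProduct (y ∷ xs)) ∎

  monomial-zeros : ∀ {n} (x : Vec Carrier n) → monomial x (V.replicate n 0) ≈ 1#
  monomial-zeros []       = refl
  monomial-zeros (x ∷ xs) = trans (*-identityˡ _) (monomial-zeros xs)

  fromBool : Bool → Carrier
  fromBool b = if b then 1# else 0#

  ∑-below-isZeroVec : ∀ {n} (cs : Vec ℕ n) (h : Vec ℕ n → Carrier) →
    ∑ (below cs) (λ a → fromBool (isZeroVec a) * h a) ≈ h (V.replicate n 0)
  ∑-below-isZeroVec []        h = trans (+-identityʳ _) (*-identityˡ _)
  ∑-below-isZeroVec (c ∷ cs) h = begin
    ∑ (below (c ∷ cs)) (λ a → fromBool (isZeroVec a) * h a)            ≈⟨ ∑-below-∷ c cs _ ⟩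
    ∑ (below cs) (λ a → fromBool (isZeroVec a) * h (0 ∷ a)) + nonzeroHeads
                                                                       ≈⟨ +-congˡ (trans (reflexive (∑-applyUpTo c suc _))
                                                                           (∑-zero (upTo c) (λ _ → ∑-zero (below cs) (λ _ → zeroˡ _)))) ⟩
    ∑ (below cs) (λ a → fromBool (isZeroVec a) * h (0 ∷ a)) + 0#       ≈⟨ +-identityʳ _ ⟩
    ∑ (below cs) (λ a → fromBool (isZeroVec a) * h (0 ∷ a))            ≈⟨ ∑-below-isZeroVec cs (λ a → h (0 ∷ a)) ⟩
    h (V.replicate _ 0)                                                ∎
    where
    nonzeroHeads : Carrier
    nonzeroHeads = ∑ (applyUpTo suc c) (λ i → ∑ (below cs) (λ a → fromBool (isZeroVec (i ∷ a)) * h (i ∷ a)))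

  mulVar : ∀ {n} → Fin n → Poly n → Poly n
  mulVar Fin.zero    g (zero  ∷ cs) = 0#
  mulVar Fin.zero    g (suc c ∷ cs) = g (c ∷ cs)
  mulVar (Fin.suc j) g (c ∷ cs)     = mulVar j (λ v → g (c ∷ v)) cs

  varP-⊛ : ∀ {n} (j : Fin n) (g : Poly n) c → (varP j ⊛ g) c ≈ mulVar j g c
  varP-⊛ Fin.zero g (zero ∷ cs) =
    trans (∑-below-∷ 0 cs _) (trans (+-identityʳ _) (∑-zero (below cs) (λ _ → zeroˡ _)))
  varP-⊛ Fin.zero g (suc c ∷ cs) = begin
    (varP Fin.zero ⊛ g) (suc c ∷ cs)                        ≈⟨ ∑-below-∷ (suc c) cs _ ⟩
    headTerm 0 + (headTerm 1 + rest)                        ≈⟨ +-cong (∑-zero (below cs) (λ _ → zeroˡ _))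
                                                                      (+-cong (∑-below-isZeroVec cs _) rest≈0) ⟩
    0# + (g (c ∷ V.zipWith _∸_ cs (V.replicate _ 0)) + 0#)  ≈⟨ trans (+-identityˡ _) (+-identityʳ _) ⟩
    g (c ∷ V.zipWith _∸_ cs (V.replicate _ 0))              ≡⟨ ≡.cong (λ v → g (c ∷ v)) (Vₚ.zipWith-identityʳ (λ _ → ≡.refl) cs) ⟩
    g (c ∷ cs)                                              ∎
    where
    headTerm : ℕ → Carrier
    headTerm i = ∑ (below cs) (λ a → varP Fin.zero (i ∷ a) * g (V.zipWith _∸_ (suc c ∷ cs) (i ∷ a)))
    rest : Carrier
    rest = ∑ (applyUpTo (suc ∘ suc) c) headTerm
    rest≈0 : rest ≈ 0#
    rest≈0 = trans (reflexive (∑-applyUpTo c (suc ∘ suc) _)) (∑-zero (upTo c) (λ _ → ∑-zero (below cs) (λ _ → zeroˡ _)))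
  varP-⊛ (Fin.suc j) g (c ∷ cs) = begin
    (varP (Fin.suc j) ⊛ g) (c ∷ cs)                       ≈⟨ ∑-below-∷ c cs _ ⟩
    (varP j ⊛ (λ v → g (c ∷ v))) cs + rest                ≈⟨ +-cong (varP-⊛ j (λ v → g (c ∷ v)) cs) rest≈0 ⟩
    mulVar j (λ v → g (c ∷ v)) cs + 0#                    ≈⟨ +-identityʳ _ ⟩
    mulVar j (λ v → g (c ∷ v)) cs                         ∎
    where
    headTerm : ℕ → Carrier
    headTerm i = ∑ (below cs) (λ a → varP (Fin.suc j) (i ∷ a) * g (V.zipWith _∸_ (c ∷ cs) (i ∷ a)))
    rest : Carrier
    rest = ∑ (applyUpTo suc c) headTerm
    rest≈0 : rest ≈ 0#
    rest≈0 = trans (reflexive (∑-applyUpTo c suc _)) (∑-zero (upTo c) (λ _ → ∑-zero (below cs) (λ _ → zeroˡ _)))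

  mulVar-incAt : ∀ {n} (j : Fin n) g a → mulVar j g (incAt j a) ≡ g a
  mulVar-incAt Fin.zero    g (a ∷ as) = ≡.refl
  mulVar-incAt (Fin.suc j) g (a ∷ as) = mulVar-incAt j (λ v → g (a ∷ v)) as

  mulVar-lookup-zero : ∀ {n} (j : Fin n) g b → V.lookup b j ≡ 0 → mulVar j g b ≈ 0#
  mulVar-lookup-zero Fin.zero    g (zero ∷ cs) _ = refl
  mulVar-lookup-zero (Fin.suc j) g (c ∷ cs)    e = mulVar-lookup-zero j (λ v → g (c ∷ v)) cs e

  _≼_ : ∀ {n} → Vec ℕ n → Vec ℕ n → Set
  v ≼ b = ∀ k → V.lookup v k ≤ V.lookup b k × V.lookup b k ≤ suc (V.lookup v k)

  mulVar-cases : ∀ {n} (j : Fin n) b →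
    (∀ g → mulVar j g b ≈ 0#) ⊎ ∃ λ v → (∀ g → mulVar j g b ≡ g v) × v ≼ b
  mulVar-cases Fin.zero (zero  ∷ cs) = inj₁ (λ _ → refl)
  mulVar-cases Fin.zero (suc c ∷ cs) = inj₂ (c ∷ cs , (λ _ → ≡.refl) , bounds)
    where
    bounds : (c ∷ cs) ≼ (suc c ∷ cs)
    bounds Fin.zero    = ℕₚ.n≤1+n c , ℕₚ.≤-refl
    bounds (Fin.suc k) = ℕₚ.≤-refl , ℕₚ.n≤1+n _
  mulVar-cases (Fin.suc j) (c ∷ cs) with mulVar-cases j cs
  ... | inj₁ vanish = inj₁ (λ g → vanish (λ w → g (c ∷ w)))
  ... | inj₂ (v , mulVar≡ , v≼cs) = inj₂ (c ∷ v , (λ g → mulVar≡ (λ w → g (c ∷ w))) , bounds)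
    where
    bounds : (c ∷ v) ≼ (c ∷ cs)
    bounds Fin.zero    = ℕₚ.≤-refl , ℕₚ.n≤1+n c
    bounds (Fin.suc k) = v≼cs k

  mulVar-vanishes : ∀ {n} (j : Fin n) g b k N →
    (∀ v → N ≤ V.lookup v k → g v ≈ 0#) → suc N ≤ V.lookup b k → mulVar j g b ≈ 0#
  mulVar-vanishes j g b k N vanish N<b with mulVar-cases j b
  ... | inj₁ zero≈         = zero≈ g
  ... | inj₂ (v , mulVar≡ , v≼b) =
    trans (reflexive (mulVar≡ g)) (vanish v (ℕ.s≤s⁻¹ (ℕₚ.≤-trans N<b (proj₂ (v≼b k)))))

  mulVar-cong-lookup-zero : ∀ {n} (j : Fin n) g g′ b k → V.lookup b k ≡ 0 →
    (∀ v → V.lookup v k ≡ 0 → g v ≈ g′ v) → mulVar j g b ≈ mulVar j g′ b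
  mulVar-cong-lookup-zero j g g′ b k b≡0 g≈g′ with mulVar-cases j b
  ... | inj₁ zero≈         = trans (zero≈ g) (sym (zero≈ g′))
  ... | inj₂ (v , mulVar≡ , v≼b) =
    trans (reflexive (mulVar≡ g)) (trans (g≈g′ v v≡0) (reflexive (≡.sym (mulVar≡ g′))))
    where
    v≡0 : V.lookup v k ≡ 0
    v≡0 = ℕₚ.n≤0⇒n≡0 (≡.subst (V.lookup v k ≤_) b≡0 (proj₁ (v≼b k)))

  constP-0# : ∀ {n} (a : Vec ℕ n) → constP 0# a ≈ 0#
  constP-0# a with isZeroVec a
  ... | true  = refl
  ... | false = refl

  constP0-⊛ : ∀ {n} (g : Poly n) c → (constP 0# ⊛ g) c ≈ 0#
  constP0-⊛ g c = ∑-zero (below c) (λ a → trans (*-congʳ (constP-0# a)) (zeroˡ _))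

  ⊕-⊛ : ∀ {n} (f h g : Poly n) c → ((f ⊕ h) ⊛ g) c ≈ (f ⊛ g) c + (h ⊛ g) c
  ⊕-⊛ f h g c = trans (∑-cong (below c) (λ _ → distribʳ _ _ _)) (∑-distrib-+ (below c) _ _)

  module _ {n} (D : ℕ) (x : Vec Carrier n) where

    evalP-cong : ∀ {f g : Poly n} → (∀ a → f a ≈ g a) → evalP D f x ≈ evalP D g x
    evalP-cong f≈g = ∑-cong (below (V.replicate n D)) (λ a → *-congʳ (f≈g a))

    evalP-zero : ∀ {f : Poly n} → (∀ a → f a ≈ 0#) → evalP D f x ≈ 0#
    evalP-zero f≈0 = ∑-zero (below (V.replicate n D)) (λ a → trans (*-congʳ (f≈0 a)) (zeroˡ _))

    evalP-⊕ : ∀ (f g : Poly n) → evalP D (f ⊕ g) x ≈ evalP D f x + evalP D g x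
    evalP-⊕ f g = trans (∑-cong (below (V.replicate n D)) (λ _ → distribʳ _ _ _))
                        (∑-distrib-+ (below (V.replicate n D)) (λ a → f a * monomial x a) (λ a → g a * monomial x a))

    evalP-scaleP : ∀ r (f : Poly n) → evalP D (scaleP r f) x ≈ r * evalP D f x
    evalP-scaleP r f = trans (∑-cong (below (V.replicate n D)) (λ _ → *-assoc _ _ _))
                             (∑-*ˡ (below (V.replicate n D)) (λ a → f a * monomial x a) r)

    evalP-constP-1# : evalP D (constP 1#) x ≈ 1#
    evalP-constP-1# = trans (∑-below-isZeroVec (V.replicate n D) (monomial x)) (monomial-zeros x)

    evalP-sumFrom : ∀ {a} {A : Set a} (js : List A) (T : A → Poly n) (base : Poly n) →
      evalP D (λ c → sumFrom js (λ i → T i c) (base c)) x ≈ sumFrom js (λ i → evalP D (T i) x) (evalP D base x)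
    evalP-sumFrom []       T base = refl
    evalP-sumFrom (j ∷ js) T base =
      trans (evalP-⊕ (T j) (λ c → sumFrom js (λ i → T i c) (base c))) (+-congˡ (evalP-sumFrom js T base))

    evalP-varP-⊛ : ∀ (j : Fin n) g → (∀ b → D ≤ V.lookup b j → g b ≈ 0#) →
      evalP D (varP j ⊛ g) x ≈ V.lookup x j * evalP D g x
    evalP-varP-⊛ j g deg<D = begin
      evalP D (varP j ⊛ g) x                               ≈⟨ ∑-cong (below rep) (λ a → *-congʳ (varP-⊛ j g a)) ⟩
      ∑ (below rep) G                                      ≈⟨ ∑-below-incAt j D G G-vanish₀ G-vanish₁ ⟨
      ∑ (below rep) (G ∘ incAt j)                          ≈⟨ ∑-cong (below rep) (λ a →
                                                               trans (*-cong (reflexive (mulVar-incAt j g a)) (monomial-incAt j x a))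
                                                                     (x∙yz≈y∙xz _ _ _)) ⟩
      ∑ (below rep) (λ a → V.lookup x j * (g a * monomial x a)) ≈⟨ ∑-*ˡ (below rep) (λ a → g a * monomial x a) (V.lookup x j) ⟩
      V.lookup x j * evalP D g x                           ∎
      where
      rep : Vec ℕ n
      rep = V.replicate n D
      G : Vec ℕ n → Carrier
      G b = mulVar j g b * monomial x b
      G-vanish₀ : ∀ b → V.lookup b j ≡ 0 → G b ≈ 0#
      G-vanish₀ b b≡0 = trans (*-congʳ (mulVar-lookup-zero j g b b≡0)) (zeroˡ _)
      G-vanish₁ : ∀ b → V.lookup b j ≡ suc D → G b ≈ 0#
      G-vanish₁ b b≡1+D = trans (*-congʳ (mulVar-vanishes j g b j D deg<D (ℕₚ.≤-reflexive (≡.sym b≡1+D)))) (zeroˡ _)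

  foldr-⊕-apply : ∀ {a} {A : Set a} {n} (xs : List A) (Fs : A → Poly n) (z : Poly n) c →
    L.foldr _⊕_ z (L.map Fs xs) c ≡ sumFrom xs (λ x → Fs x c) (z c)
  foldr-⊕-apply []       Fs z c = ≡.refl
  foldr-⊕-apply (x ∷ xs) Fs z c = ≡.cong (Fs x c +_) (foldr-⊕-apply xs Fs z c)

  foldr-⊕-⊛ : ∀ {a} {A : Set a} {n} (js : List A) (Fs : A → Poly n) (base g : Poly n) c →
    (L.foldr _⊕_ base (L.map Fs js) ⊛ g) c ≈ sumFrom js (λ i → (Fs i ⊛ g) c) ((base ⊛ g) c)
  foldr-⊕-⊛ []       Fs base g c = refl
  foldr-⊕-⊛ (j ∷ js) Fs base g c = trans (⊕-⊛ (Fs j) _ g c) (+-congˡ (foldr-⊕-⊛ js Fs base g c))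

  isZeroVec-false : ∀ {n} (b : Vec ℕ n) k → 0 < V.lookup b k → isZeroVec b ≡ false
  isZeroVec-false {n} b k 0<b with ≡-dec ℕ._≟_ b (V.replicate n 0)
  ... | yes ≡.refl = ⊥-elim (ℕₚ.<-irrefl (≡.sym (Vₚ.lookup-replicate k 0)) 0<b)
  ... | no _       = ≡.refl

  if-zero : ∀ b {y} → y ≈ 0# → (if b then y else 0#) ≈ 0#
  if-zero true  y≈0 = y≈0
  if-zero false _   = refl

  module LinearForm (m : ℕ) where

    linFormVal : Vec Bool m → Vec Carrier (suc m) → Carrier
    linFormVal I x =
      sumFrom (allFin m) (λ i → if V.lookup I i then V.lookup x (inject₁ i) else 0#) (V.lookup x (fromℕ m))

    selectVar : Bool → Fin (suc m) → Poly (suc m)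
    selectVar b j = if b then varP j else constP 0#

    selectVar-⊛ : ∀ b j g c → (selectVar b j ⊛ g) c ≈ (if b then mulVar j g c else 0#)
    selectVar-⊛ true  j g c = varP-⊛ j g c
    selectVar-⊛ false j g c = constP0-⊛ g c

    linForm-⊛ : ∀ (I : Vec Bool m) g c → (linForm I ⊛ g) c ≈
      sumFrom (allFin m) (λ i → if V.lookup I i then mulVar (inject₁ i) g c else 0#) (mulVar (fromℕ m) g c)
    linForm-⊛ I g c = trans (foldr-⊕-⊛ (allFin m) _ (varP (fromℕ m)) g c)
      (sumFrom-cong (allFin m) (λ i → selectVar-⊛ (V.lookup I i) (inject₁ i) g c) (varP-⊛ (fromℕ m) g c))

    evalP-selectVar-⊛ : ∀ D b j g x → (∀ c → D ≤ V.lookup c j → g c ≈ 0#) →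
      evalP D (selectVar b j ⊛ g) x ≈ (if b then V.lookup x j else 0#) * evalP D g x
    evalP-selectVar-⊛ D true  j g x deg<D = evalP-varP-⊛ D x j g deg<D
    evalP-selectVar-⊛ D false j g x deg<D = trans (evalP-zero D x (constP0-⊛ g)) (sym (zeroˡ _))

    evalP-linForm-⊛ : ∀ D (I : Vec Bool m) g x → (∀ c j → D ≤ V.lookup c j → g c ≈ 0#) →
      evalP D (linForm I ⊛ g) x ≈ linFormVal I x * evalP D g x
    evalP-linForm-⊛ D I g x deg<D = begin
      evalP D (linForm I ⊛ g) x
        ≈⟨ evalP-cong D x (foldr-⊕-⊛ (allFin m) Fs (varP (fromℕ m)) g) ⟩
      evalP D (λ c → sumFrom (allFin m) (λ i → (Fs i ⊛ g) c) ((varP (fromℕ m) ⊛ g) c)) x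
        ≈⟨ evalP-sumFrom D x (allFin m) (λ i → Fs i ⊛ g) (varP (fromℕ m) ⊛ g) ⟩
      sumFrom (allFin m) (λ i → evalP D (Fs i ⊛ g) x) (evalP D (varP (fromℕ m) ⊛ g) x)
        ≈⟨ sumFrom-cong (allFin m) (λ i → evalP-selectVar-⊛ D (V.lookup I i) (inject₁ i) g x (λ c → deg<D c (inject₁ i)))
                                   (evalP-varP-⊛ D x (fromℕ m) g (λ c → deg<D c (fromℕ m))) ⟩
      sumFrom (allFin m) (λ i → (if V.lookup I i then V.lookup x (inject₁ i) else 0#) * evalP D g x)
                         (V.lookup x (fromℕ m) * evalP D g x)
        ≈⟨ sumFrom-*ʳ (allFin m) _ _ _ ⟩
      linFormVal I x * evalP D g x ∎
      where
      Fs : Fin m → Poly (suc m)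
      Fs i = selectVar (V.lookup I i) (inject₁ i)

    linForm^P-vanishes : ∀ (I : Vec Bool m) n b k → n < V.lookup b k → (linForm I ^P n) b ≈ 0#
    linForm^P-vanishes I zero    b k n<b = reflexive (≡.cong fromBool (isZeroVec-false b k n<b))
    linForm^P-vanishes I (suc n) b k n<b = trans (linForm-⊛ I (linForm I ^P n) b)
      (sumFrom-zero (allFin m) (λ i → if-zero (V.lookup I i) (vanish (inject₁ i))) (vanish (fromℕ m)))
      where
      vanish : ∀ j → mulVar j (linForm I ^P n) b ≈ 0#
      vanish j = mulVar-vanishes j _ b k (suc n) (λ v → linForm^P-vanishes I n v k) n<b

    evalP-linForm^P : ∀ (I : Vec Bool m) n D x → n < D → evalP D (linForm I ^P n) x ≈ pow (linFormVal I x) n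
    evalP-linForm^P I zero    D x _   = evalP-constP-1# D x
    evalP-linForm^P I (suc n) D x n<D = trans
      (evalP-linForm-⊛ D I (linForm I ^P n) x (λ c j D≤c → linForm^P-vanishes I n c j (ℕₚ.<-≤-trans n<D′ D≤c)))
      (*-congˡ (evalP-linForm^P I n D x n<D′))
      where
      n<D′ : n < D
      n<D′ = ℕₚ.<⇒≤ n<D

    linForm^P-indep : ∀ n (i : Fin m) (I I′ : Vec Bool m) → (∀ j → j ≢ i → V.lookup I j ≡ V.lookup I′ j) →
      ∀ c → V.lookup c (inject₁ i) ≡ 0 → (linForm I ^P n) c ≈ (linForm I′ ^P n) c
    linForm^P-indep zero    i I I′ I≈I′ c c≡0 = refl
    linForm^P-indep (suc n) i I I′ I≈I′ c c≡0 = begin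
      (linForm I ^P suc n) c                                                    ≈⟨ linForm-⊛ I _ c ⟩
      sumFrom (allFin m) (λ j → if V.lookup I j then X j else 0#) (mulVar (fromℕ m) (linForm I ^P n) c)
        ≈⟨ sumFrom-cong (allFin m) term (mulVar-cong-lookup-zero (fromℕ m) _ _ c (inject₁ i) c≡0 IH) ⟩
      sumFrom (allFin m) (λ j → if V.lookup I′ j then X′ j else 0#) (mulVar (fromℕ m) (linForm I′ ^P n) c)
        ≈⟨ linForm-⊛ I′ _ c ⟨
      (linForm I′ ^P suc n) c                                                   ∎
      where
      IH : ∀ v → V.lookup v (inject₁ i) ≡ 0 → (linForm I ^P n) v ≈ (linForm I′ ^P n) v
      IH = linForm^P-indep n i I I′ I≈I′
      X X′ : Fin m → Carrier
      X  j = mulVar (inject₁ j) (linForm I ^P n) c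
      X′ j = mulVar (inject₁ j) (linForm I′ ^P n) c
      X≈X′ : ∀ j → X j ≈ X′ j
      X≈X′ j = mulVar-cong-lookup-zero (inject₁ j) _ _ c (inject₁ i) c≡0 IH
      term : ∀ j → (if V.lookup I j then X j else 0#) ≈ (if V.lookup I′ j then X′ j else 0#)
      term j with j Fin.≟ i
      ... | yes ≡.refl = trans (if-zero (V.lookup I j) (mulVar-lookup-zero (inject₁ j) _ c c≡0))
                               (sym (if-zero (V.lookup I′ j) (mulVar-lookup-zero (inject₁ j) _ c c≡0)))
      ... | no j≢i rewrite I≈I′ j j≢i with V.lookup I′ j
      ...   | true  = X≈X′ j
      ...   | false = refl

  card-updateAt : ∀ {m} (I : Vec Bool m) i →
    card (V.updateAt I i (λ _ → true)) ≡ suc (card (V.updateAt I i (λ _ → false)))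
  card-updateAt (b ∷ I)     Fin.zero    = ≡.refl
  card-updateAt (true ∷ I)  (Fin.suc i) = ≡.cong suc (card-updateAt I i)
  card-updateAt (false ∷ I) (Fin.suc i) = card-updateAt I i

  even-suc : ∀ n → even (suc n) ≡ not (even n)
  even-suc zero          = ≡.refl
  even-suc (suc zero)    = ≡.refl
  even-suc (suc (suc n)) = even-suc n

  sign-suc : ∀ n → sign (suc n) ≈ - sign n
  sign-suc n rewrite even-suc n with even n
  ... | true  = refl
  ... | false = sym (-‿involutive 1#)
    where open import Algebra.Properties.Ring ring using (-‿involutive)

  module Numerator (m : ℕ) where
    open LinearForm m

    term : Vec Bool m → Poly (suc m)
    term I = scaleP (sign (suc (card I))) (linForm I ^P (q ∸ 1))

    numer-coeff : ∀ b → numer m b ≈ ∑ (subsets m) (λ I → term I b)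
    numer-coeff b = trans (reflexive (foldr-⊕-apply (subsets m) term (constP 0#) b))
                          (sumFrom-cong (subsets m) (λ _ → refl) (constP-0# b))

    -- I and I ∪ {i} carry opposite signs, and on monomials free of x_i the
    -- powers of x_I + x_p and x_{I ∪ {i}} + x_p have the same coefficients.
    numer-vanishes-below : ∀ b (i : Fin m) → V.lookup b (inject₁ i) ≡ 0 → numer m b ≈ 0#
    numer-vanishes-below b i b≡0 = trans (numer-coeff b) (∑-subsets-pairing m i (λ I → term I b) cancel)
      where
      cancel : ∀ I → term (V.updateAt I i (λ _ → false)) b + term (V.updateAt I i (λ _ → true)) b ≈ 0#
      cancel I = begin
        s * L₀ b + sign (suc (card I₁)) * L₁ b ≈⟨ +-congˡ (*-cong (trans (reflexive (≡.cong (sign ∘ suc) (card-updateAt I i)))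
                                                                         (sign-suc (suc (card I₀))))
                                                                  (linForm^P-indep (q ∸ 1) i I₁ I₀ agree b b≡0)) ⟩
        s * L₀ b + (- s) * L₀ b                ≈⟨ distribʳ _ s (- s) ⟨
        (s + - s) * L₀ b                        ≈⟨ *-congʳ (-‿inverseʳ s) ⟩
        0# * L₀ b                               ≈⟨ zeroˡ _ ⟩
        0#                                      ∎
        where
        I₀ I₁ : Vec Bool m
        I₀ = V.updateAt I i (λ _ → false)
        I₁ = V.updateAt I i (λ _ → true)
        s : Carrier
        s = sign (suc (card I₀))
        L₀ L₁ : Poly (suc m)
        L₀ = linForm I₀ ^P (q ∸ 1)
        L₁ = linForm I₁ ^P (q ∸ 1)
        agree : ∀ j → j ≢ i → V.lookup I₁ j ≡ V.lookup I₀ j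
        agree j j≢i = ≡.trans (Vₚ.lookup∘updateAt′ j i j≢i I) (≡.sym (Vₚ.lookup∘updateAt′ j i j≢i I))

    numer-vanishes-above : ∀ b k → q ∸ 1 < V.lookup b k → numer m b ≈ 0#
    numer-vanishes-above b k q-1<b = trans (numer-coeff b)
      (∑-zero (subsets m) (λ I → trans (*-congˡ (linForm^P-vanishes I (q ∸ 1) b k q-1<b)) (zeroʳ _)))

    -- The exact division by x₁⋯x_{p-1} is the exponent shift bump; undoing it loses no term
    -- because numer has no monomial missing some x_i (i < p), nor one of degree ≥ q in any variable.
    evalP-Ppoly : ∀ x → evalP q (Ppoly m) x * initProduct x ≈ evalP q (numer m) x
    evalP-Ppoly x = begin
      evalP q (Ppoly m) x * initProduct x                         ≈⟨ ∑-*ʳ (below rep) (λ a → Ppoly m a * monomial x a) _ ⟨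
      ∑ (below rep) (λ a → (numer m (bump a) * monomial x a) * initProduct x)
        ≈⟨ ∑-cong (below rep) (λ a → trans (*-assoc _ _ _) (*-congˡ (sym (monomial-bump x a)))) ⟩
      ∑ (below rep) (G ∘ bump)                                    ≈⟨ ∑-below-bump m q G vanish₀ vanish₁ ⟩
      ∑ (below rep) G                                             ∎
      where
      rep : Vec ℕ (suc m)
      rep = V.replicate (suc m) q
      G : Vec ℕ (suc m) → Carrier
      G b = numer m b * monomial x b
      vanish₀ : ∀ b (i : Fin m) → V.lookup b (inject₁ i) ≡ 0 → G b ≈ 0#
      vanish₀ b i b≡0 = trans (*-congʳ (numer-vanishes-below b i b≡0)) (zeroˡ _)
      vanish₁ : ∀ b (i : Fin m) → V.lookup b (inject₁ i) ≡ suc q → G b ≈ 0#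
      vanish₁ b i b≡1+q = trans (*-congʳ (numer-vanishes-above b (inject₁ i)
        (≡.subst (q ∸ 1 <_) (≡.sym b≡1+q) (s≤s (ℕₚ.m∸n≤m q 1))))) (zeroˡ _)

    evalP-numer : 0 < q → ∀ x →
      evalP q (numer m) x ≈ ∑ (subsets m) (λ I → sign (suc (card I)) * pow (linFormVal I x) (q ∸ 1))
    evalP-numer 0<q x = begin
      evalP q (numer m) x                                              ≈⟨ evalP-cong q x (λ c → reflexive (foldr-⊕-apply (subsets m) term (constP 0#) c)) ⟩
      evalP q (λ c → sumFrom (subsets m) (λ I → term I c) (constP 0# c)) x ≈⟨ evalP-sumFrom q x (subsets m) term (constP 0#) ⟩
      sumFrom (subsets m) (λ I → evalP q (term I) x) (evalP q (constP 0#) x)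
        ≈⟨ sumFrom-cong (subsets m) (λ I → trans (evalP-scaleP q x _ _) (*-congˡ (evalP-linForm^P I (q ∸ 1) q x q-1<q)))
                                    (evalP-zero q x constP-0#) ⟩
      ∑ (subsets m) (λ I → sign (suc (card I)) * pow (linFormVal I x) (q ∸ 1)) ∎
      where
      q-1<q : q ∸ 1 < q
      q-1<q = ℕₚ.∸-monoʳ-< {q} {1} {0} (s≤s z≤n) 0<q

module FiniteFieldProperties {c ℓ q} (F : FiniteField c ℓ q) where
  open FiniteField F
  open Construction F
  open import Algebra.Properties.CommutativeMonoid.Sum *-commutativeMonoid
    using (sum-permute; ∑-distrib-+; sum-remove; sum-cong-≋) renaming (sum to ∏)
  open import Data.Fin.Permutation using (Permutation′; permutation)
  open import Relation.Binary.Reasoning.Setoid setoid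

  isZero : Carrier → Bool
  isZero y = does (y ≟ 0#)

  isZero⇒≈0 : ∀ {y} → isZero y ≡ true → y ≈ 0#
  isZero⇒≈0 {y} isZero≡true with y ≟ 0#
  ... | yes y≈0 = y≈0

  ¬isZero⇒≉0 : ∀ {y} → isZero y ≡ false → ¬ y ≈ 0#
  ¬isZero⇒≉0 {y} isZero≡false with y ≟ 0#
  ... | no y≉0 = y≉0

  nonzero⇒≉0 : ∀ {y} → nonzero y ≡ true → ¬ y ≈ 0#
  nonzero⇒≉0 {y} nonzero≡true with y ≟ 0#
  ... | no y≉0 = y≉0

  ≉0⇒nonzero : ∀ {y} → ¬ y ≈ 0# → nonzero y ≡ true
  ≉0⇒nonzero {y} y≉0 with y ≟ 0#
  ... | yes y≈0 = ⊥-elim (y≉0 y≈0)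
  ... | no _    = ≡.refl

  *-≉0 : ∀ {x y} → ¬ x ≈ 0# → ¬ y ≈ 0# → ¬ x * y ≈ 0#
  *-≉0 {x} {y} x≉0 y≉0 xy≈0 with inverse x x≉0
  ... | x⁻¹ , xx⁻¹≈1 = y≉0 (begin
    y                ≈⟨ *-identityˡ y ⟨
    1# * y           ≈⟨ *-congʳ (trans (sym xx⁻¹≈1) (*-comm x x⁻¹)) ⟩
    (x⁻¹ * x) * y    ≈⟨ *-assoc x⁻¹ x y ⟩
    x⁻¹ * (x * y)    ≈⟨ *-congˡ xy≈0 ⟩
    x⁻¹ * 0#         ≈⟨ zeroʳ x⁻¹ ⟩
    0#               ∎)

  *-cancelʳ-≉0 : ∀ {a b g} → ¬ g ≈ 0# → a * g ≈ b * g → a ≈ b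
  *-cancelʳ-≉0 {a} {b} {g} g≉0 ag≈bg with inverse g g≉0
  ... | g⁻¹ , gg⁻¹≈1 = begin
    a                ≈⟨ *-identityʳ a ⟨
    a * 1#           ≈⟨ *-congˡ gg⁻¹≈1 ⟨
    a * (g * g⁻¹)    ≈⟨ *-assoc a g g⁻¹ ⟨
    (a * g) * g⁻¹    ≈⟨ *-congʳ ag≈bg ⟩
    (b * g) * g⁻¹    ≈⟨ *-assoc b g g⁻¹ ⟩
    b * (g * g⁻¹)    ≈⟨ *-congˡ gg⁻¹≈1 ⟩
    b * 1#           ≈⟨ *-identityʳ b ⟩
    b                ∎

  ∏-≉0⇒all-nonzero : ∀ {a} {A : Set a} (f : A → Carrier) xs →
    ¬ L.foldr _*_ 1# (L.map f xs) ≈ 0# → all (nonzero ∘ f) xs ≡ true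
  ∏-≉0⇒all-nonzero f []       _  = ≡.refl
  ∏-≉0⇒all-nonzero f (x ∷ xs) ∏≉0 = ≡.cong₂ _∧_
    (≉0⇒nonzero (λ fx≈0 → ∏≉0 (trans (*-congʳ fx≈0) (zeroˡ _))))
    (∏-≉0⇒all-nonzero f xs (λ ∏xs≈0 → ∏≉0 (trans (*-congˡ ∏xs≈0) (zeroʳ _))))

  ∏-≉0 : ∀ {n} (t : Fin n → Carrier) → (∀ i → ¬ t i ≈ 0#) → ¬ ∏ t ≈ 0#
  ∏-≉0 {zero}  t t≉0 = 1≉0
  ∏-≉0 {suc n} t t≉0 = *-≉0 (t≉0 Fin.zero) (∏-≉0 (t ∘ Fin.suc) (t≉0 ∘ Fin.suc))

  ∏-replicate : ∀ n y → ∏ {n} (λ _ → y) ≈ pow y n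
  ∏-replicate zero    y = refl
  ∏-replicate (suc n) y = *-congˡ (∏-replicate n y)

  ∏-const-except : ∀ {n} (i : Fin n) y (t : Fin n → Carrier) →
    t i ≈ 1# → (∀ j → j ≢ i → t j ≈ y) → ∏ t ≈ pow y (n ∸ 1)
  ∏-const-except {suc n} i y t tᵢ≈1 tⱼ≈y = begin
    ∏ t                                  ≈⟨ sum-remove {i = i} t ⟩
    t i * ∏ (λ j → t (Fin.punchIn i j))  ≈⟨ *-cong tᵢ≈1 (sum-cong-≋ (λ j → tⱼ≈y _ (Finₚ.punchInᵢ≢i i j))) ⟩
    1# * ∏ {n} (λ _ → y)                 ≈⟨ *-identityˡ _ ⟩
    ∏ {n} (λ _ → y)                      ≈⟨ ∏-replicate n y ⟩
    pow y n                              ∎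

  scaleBy : Carrier → Fin q → Fin q
  scaleBy z j = proj₁ (enum-surjective (z * enum j))

  enum-scaleBy : ∀ z j → enum (scaleBy z j) ≈ z * enum j
  enum-scaleBy z j = proj₂ (enum-surjective (z * enum j))

  scaleBy-inverse : ∀ {z z′} → z * z′ ≈ 1# → ∀ j → scaleBy z (scaleBy z′ j) ≡ j
  scaleBy-inverse {z} {z′} zz′≈1 j = enum-injective _ _ (begin
    enum (scaleBy z (scaleBy z′ j)) ≈⟨ enum-scaleBy z _ ⟩
    z * enum (scaleBy z′ j)         ≈⟨ *-congˡ (enum-scaleBy z′ j) ⟩
    z * (z′ * enum j)               ≈⟨ *-assoc z z′ _ ⟨
    (z * z′) * enum j               ≈⟨ *-congʳ zz′≈1 ⟩
    1# * enum j                     ≈⟨ *-identityˡ _ ⟩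
    enum j                          ∎)

  scaleBy-permutation : ∀ {z z′} → z * z′ ≈ 1# → Permutation′ q
  scaleBy-permutation {z} {z′} zz′≈1 =
    permutation (scaleBy z) (scaleBy z′) (scaleBy-inverse zz′≈1) (scaleBy-inverse (trans (*-comm z′ z) zz′≈1))

  -- Multiplication by y permutes F, so ∏_{x ≠ 0} x = ∏_{x ≠ 0} y x = y^(q-1) ∏_{x ≠ 0} x;
  -- the product over x ≠ 0 is taken over all of F with the factor at 0 replaced by 1.
  fermat : ∀ y → ¬ y ≈ 0# → pow y (q ∸ 1) ≈ 1#
  fermat y y≉0 with inverse y y≉0 | enum-surjective 0#
  ... | y⁻¹ , yy⁻¹≈1 | i₀ , enum-i₀≈0 = *-cancelʳ-≉0 (∏-≉0 g g≉0) (begin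
    pow y (q ∸ 1) * ∏ g            ≈⟨ *-congʳ (∏-const-except i₀ y factor factor-i₀ factor-j) ⟨
    ∏ factor * ∏ g                 ≈⟨ ∑-distrib-+ factor g ⟨
    ∏ (λ j → factor j * g j)       ≈⟨ sum-cong-≋ g∘scaleBy ⟨
    ∏ (g ∘ scaleBy y)              ≈⟨ sum-permute g (scaleBy-permutation yy⁻¹≈1) ⟨
    ∏ g                            ≈⟨ *-identityˡ _ ⟨
    1# * ∏ g                       ∎)
    where
    g factor : Fin q → Carrier
    g j = if isZero (enum j) then 1# else enum j
    factor j = if isZero (enum j) then 1# else y
    g≉0 : ∀ j → ¬ g j ≈ 0#
    g≉0 j with enum j ≟ 0#
    ... | yes _   = 1≉0
    ... | no ej≉0 = ej≉0
    g∘scaleBy : ∀ j → g (scaleBy y j) ≈ factor j * g j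
    g∘scaleBy j with enum j ≟ 0# | enum (scaleBy y j) ≟ 0#
    ... | yes _    | yes _     = sym (*-identityˡ 1#)
    ... | yes ej≈0 | no eσj≉0  = ⊥-elim (eσj≉0 (trans (enum-scaleBy y j) (trans (*-congˡ ej≈0) (zeroʳ y))))
    ... | no ej≉0  | yes eσj≈0 = ⊥-elim (*-≉0 y≉0 ej≉0 (trans (sym (enum-scaleBy y j)) eσj≈0))
    ... | no _     | no _      = enum-scaleBy y j
    factor-i₀ : factor i₀ ≈ 1#
    factor-i₀ with enum i₀ ≟ 0#
    ... | yes _    = refl
    ... | no ei₀≉0 = ⊥-elim (ei₀≉0 enum-i₀≈0)
    factor-j : ∀ j → j ≢ i₀ → factor j ≈ y
    factor-j j j≢i₀ with enum j ≟ 0#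
    ... | yes ej≈0 = ⊥-elim (j≢i₀ (enum-injective _ _ (trans ej≈0 (sym enum-i₀≈0))))
    ... | no _     = refl

module SupportOfP {c ℓ q} (F : FiniteField c ℓ q) where
  open FiniteField F
  open Construction F
  open ListSum semiring
  open PolyEvaluation F
  open FiniteFieldProperties F
  open import Relation.Binary.Reasoning.Setoid setoid

  initProduct-≉0 : ∀ {m} (x : Vec Carrier (suc m)) → anyInit isZero x ≡ false → ¬ initProduct x ≈ 0#
  initProduct-≉0 {zero}  (x ∷ [])     _     = 1≉0
  initProduct-≉0 {suc m} (x ∷ y ∷ xs) ¬zero =
    *-≉0 (¬isZero⇒≉0 (Boolₚ.∨-conicalˡ _ _ ¬zero)) (initProduct-≉0 (y ∷ xs) (Boolₚ.∨-conicalʳ (isZero x) _ ¬zero))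

  ∑-sign-subsets : ∀ m → ∑ (subsets (suc m)) (λ I → sign (suc (card I))) ≈ 0#
  ∑-sign-subsets m = ∑-subsets-pairing (suc m) Fin.zero _
    (λ { (_ ∷ I) → trans (+-congˡ (sign-suc (suc (card I)))) (-‿inverseʳ _) })

  Pval-vanishes : 0 < q → ∀ m (x : Vec Carrier (suc (suc m))) → anyInit isZero x ≡ false →
    any (λ I → isZero (LinearForm.linFormVal (suc m) I x)) (subsets (suc m)) ≡ false →
    Pval (suc (suc m)) x ≈ 0#
  Pval-vanishes 0<q m x ¬zero ¬linZero = *-cancelʳ-≉0 (initProduct-≉0 x ¬zero) (begin
    evalP q (Ppoly (suc m)) x * initProduct x                                       ≈⟨ evalP-Ppoly x ⟩
    evalP q (numer (suc m)) x                                                       ≈⟨ evalP-numer 0<q x ⟩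
    ∑ (subsets (suc m)) (λ I → sign (suc (card I)) * pow (linFormVal I x) (q ∸ 1))  ≈⟨ ∑-cong-¬any (subsets (suc m)) _ ¬linZero
                                                                                         (λ I ¬z → trans (*-congˡ (fermat _ (¬isZero⇒≉0 ¬z))) (*-identityʳ _)) ⟩
    ∑ (subsets (suc m)) (λ I → sign (suc (card I)))                                 ≈⟨ ∑-sign-subsets m ⟩
    0#                                                                              ≈⟨ zeroˡ _ ⟨
    0# * initProduct x                                                              ∎)
    where
    open Numerator (suc m)
    open LinearForm (suc m)

  Pval-support : 0 < q → ∀ m (x : Vec Carrier (suc (suc m))) → nonzero (Pval (suc (suc m)) x) ≡ true →
    (anyInit isZero x ∨ any (λ I → isZero (LinearForm.linFormVal (suc m) I x)) (subsets (suc m))) ≡ true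
  Pval-support 0<q m x Pval≉0
    with anyInit isZero x in zeroInit
       | any (λ I → isZero (LinearForm.linFormVal (suc m) I x)) (subsets (suc m)) in linZero
  ... | true  | _     = ≡.refl
  ... | false | true  = ≡.refl
  ... | false | false = ⊥-elim (nonzero⇒≉0 Pval≉0 (Pval-vanishes 0<q m x zeroInit linZero))

  module _ (m : ℕ) where
    open LinearForm m

    partialSum : Vec Bool m → Vec Carrier m → Carrier
    partialSum I u = ∑ (allFin m) (λ i → if V.lookup I i then V.lookup u i else 0#)

    linFormVal-∷ʳ : ∀ I (u : Vec Carrier m) y → linFormVal I (u V.∷ʳ y) ≈ partialSum I u + y
    linFormVal-∷ʳ I u y = trans
      (sumFrom-cong (allFin m) (λ i → reflexive (≡.cong (λ z → if V.lookup I i then z else 0#) (lookup-∷ʳ-inject₁ u y i)))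
                               (reflexive (lookup-∷ʳ-last u y)))
      (sumFrom-split (allFin m) _ y)

    linFormVal-root-unique : ∀ I (u : Vec Carrier m) y y′ →
      isZero (linFormVal I (u V.∷ʳ y)) ≡ true → isZero (linFormVal I (u V.∷ʳ y′)) ≡ true → y ≈ y′
    linFormVal-root-unique I u y y′ root root′ = ∙-cancelˡ (partialSum I u) y y′ (begin
      partialSum I u + y           ≈⟨ linFormVal-∷ʳ I u y ⟨
      linFormVal I (u V.∷ʳ y)      ≈⟨ isZero⇒≈0 root ⟩
      0#                           ≈⟨ isZero⇒≈0 root′ ⟨
      linFormVal I (u V.∷ʳ y′)     ≈⟨ linFormVal-∷ʳ I u y′ ⟩
      partialSum I u + y′          ∎)
      where open import Algebra.Properties.Group +-group using (∙-cancelˡ)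

  H-nonzero⇒allBlocks : ∀ p′ B t e (x : Vec Carrier (B ℕ.* suc p′ ℕ.+ t)) →
    nonzero (H (suc p′) (B ℕ.* suc p′) t e x) ≡ true →
    Blocks.allBlocks 0# (suc p′) (nonzero ∘ Pval (suc p′)) B x ≡ true
  H-nonzero⇒allBlocks p′ B t e x H≢0 =
    ≡.subst (λ n → allBlocks (nonzero ∘ Pval p) n x ≡ true) (DivMod.m*n/n≡m B p)
      (∏-≉0⇒all-nonzero (λ i → Pval p (blockAt x i)) (upTo (B ℕ.* p ℕ./ p))
        (λ ∏≈0 → nonzero⇒≉0 H≢0 (trans (*-congʳ ∏≈0) (zeroˡ _))))
    where
    p : ℕ
    p = suc p′
    open Blocks 0# p

module Counting where
  open import Data.Nat using (_+_; _*_; _^_)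
  open ListSum ℕₚ.+-*-semiring
  open import Algebra.Properties.CommutativeSemigroup ℕₚ.*-commutativeSemigroup using (x∙yz≈y∙xz)
  open ℕₚ.≤-Reasoning

  private variable
    a b : Level
    A : Set a
    B : Set b

  count : (A → Bool) → List A → ℕ
  count P xs = length (filterᵇ P xs)

  indicator : Bool → ℕ
  indicator true  = 1
  indicator false = 0

  indicator-mono : ∀ {b b′ : Bool} → (b ≡ true → b′ ≡ true) → indicator b ≤ indicator b′
  indicator-mono {false} _    = z≤n
  indicator-mono {true}  b⇒b′ rewrite b⇒b′ ≡.refl = ℕₚ.≤-refl

  indicator-∨ : ∀ b b′ → indicator (b ∨ b′) ≤ indicator b + indicator b′
  indicator-∨ true  _ = s≤s z≤n
  indicator-∨ false _ = ℕₚ.≤-refl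

  count-∑ : ∀ (P : A → Bool) xs → count P xs ≡ ∑ xs (indicator ∘ P)
  count-∑ P []       = ≡.refl
  count-∑ P (x ∷ xs) with P x
  ... | true  = ≡.cong suc (count-∑ P xs)
  ... | false = count-∑ P xs

  ∑-mono-≤ : ∀ (xs : List A) {f g : A → ℕ} → (∀ x → f x ≤ g x) → ∑ xs f ≤ ∑ xs g
  ∑-mono-≤ []       f≤g = z≤n
  ∑-mono-≤ (x ∷ xs) f≤g = ℕₚ.+-mono-≤ (f≤g x) (∑-mono-≤ xs f≤g)

  ∑-const : ∀ (xs : List A) c → ∑ xs (λ _ → c) ≡ length xs * c
  ∑-const []       c = ≡.refl
  ∑-const (x ∷ xs) c = ≡.cong (c +_) (∑-const xs c)

  count-mono : ∀ (P Q : A → Bool) xs → (∀ x → P x ≡ true → Q x ≡ true) → count P xs ≤ count Q xs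
  count-mono P Q xs P⇒Q = begin
    count P xs              ≡⟨ count-∑ P xs ⟩
    ∑ xs (indicator ∘ P)    ≤⟨ ∑-mono-≤ xs (λ x → indicator-mono (P⇒Q x)) ⟩
    ∑ xs (indicator ∘ Q)    ≡⟨ count-∑ Q xs ⟨
    count Q xs              ∎

  count-∨ : ∀ (P Q : A → Bool) xs → count (λ x → P x ∨ Q x) xs ≤ count P xs + count Q xs
  count-∨ P Q xs = begin
    count (λ x → P x ∨ Q x) xs                    ≡⟨ count-∑ _ xs ⟩
    ∑ xs (λ x → indicator (P x ∨ Q x))            ≤⟨ ∑-mono-≤ xs (λ x → indicator-∨ (P x) (Q x)) ⟩
    ∑ xs (λ x → indicator (P x) + indicator (Q x)) ≡⟨ ∑-distrib-+ xs _ _ ⟩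
    ∑ xs (indicator ∘ P) + ∑ xs (indicator ∘ Q)   ≡⟨ ≡.cong₂ _+_ (count-∑ P xs) (count-∑ Q xs) ⟨
    count P xs + count Q xs                       ∎

  count-any : ∀ (Q : B → A → Bool) (Is : List B) xs →
    count (λ x → any (λ I → Q I x) Is) xs ≤ ∑ Is (λ I → count (Q I) xs)
  count-any Q []       xs = ℕₚ.≤-reflexive (≡.trans (count-∑ _ xs) (∑-zero xs (λ _ → ≡.refl)))
  count-any Q (I ∷ Is) xs = ℕₚ.≤-trans (count-∨ (Q I) _ xs) (ℕₚ.+-monoʳ-≤ (count (Q I) xs) (count-any Q Is xs))

  count-const : ∀ (b : Bool) (xs : List A) → count (λ _ → b) xs ≡ indicator b * length xs
  count-const b xs = ≡.trans (count-∑ _ xs) (≡.trans (∑-const xs (indicator b)) (ℕₚ.*-comm (length xs) _))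

  count-allVecs-suc : ∀ n (P : Vec A (suc n) → Bool) (xs : List A) →
    count P (allVecs xs (suc n)) ≡ ∑ xs (λ x → count (λ v → P (x ∷ v)) (allVecs xs n))
  count-allVecs-suc n P xs = begin-equality
    count P (allVecs xs (suc n))                                     ≡⟨ count-∑ P (allVecs xs (suc n)) ⟩
    ∑ (allVecs xs (suc n)) (indicator ∘ P)                           ≡⟨ ∑-concatMap xs (λ x → L.map (x ∷_) (allVecs xs n)) _ ⟩
    ∑ xs (λ x → ∑ (L.map (x ∷_) (allVecs xs n)) (indicator ∘ P))     ≡⟨ ∑-cong xs (λ x → ∑-map (allVecs xs n) (x ∷_) _) ⟩
    ∑ xs (λ x → ∑ (allVecs xs n) (λ v → indicator (P (x ∷ v))))      ≡⟨ ∑-cong xs (λ x → count-∑ _ (allVecs xs n)) ⟨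
    ∑ xs (λ x → count (λ v → P (x ∷ v)) (allVecs xs n))              ∎

  count-true : ∀ (xs : List A) → count (λ _ → true) xs ≡ length xs
  count-true []       = ≡.refl
  count-true (x ∷ xs) = ≡.cong suc (count-true xs)

  length-allVecs : ∀ (xs : List A) n → length (allVecs xs n) ≡ length xs ^ n
  length-allVecs xs zero    = ≡.refl
  length-allVecs xs (suc n) = begin-equality
    length (allVecs xs (suc n))                          ≡⟨ count-true (allVecs xs (suc n)) ⟨
    count (λ _ → true) (allVecs xs (suc n))              ≡⟨ count-allVecs-suc n _ xs ⟩
    ∑ xs (λ _ → count (λ _ → true) (allVecs xs n))       ≡⟨ ∑-cong xs (λ _ → ≡.trans (count-true (allVecs xs n)) (length-allVecs xs n)) ⟩
    ∑ xs (λ _ → length xs ^ n)                           ≡⟨ ∑-const xs _ ⟩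
    length xs * length xs ^ n                            ∎

  count-tabulate-none : ∀ {k} (f : Fin k → A) (P : A → Bool) → (∀ j → P (f j) ≡ false) → count P (L.tabulate f) ≡ 0
  count-tabulate-none {k = zero}  f P ¬P = ≡.refl
  count-tabulate-none {k = suc k} f P ¬P rewrite ¬P Fin.zero = count-tabulate-none (f ∘ Fin.suc) P (¬P ∘ Fin.suc)

  count-tabulate-≤1 : ∀ {k} (f : Fin k → A) (P : A → Bool) →
    (∀ i j → P (f i) ≡ true → P (f j) ≡ true → i ≡ j) → count P (L.tabulate f) ≤ 1
  count-tabulate-≤1 {k = zero}  f P unique = z≤n
  count-tabulate-≤1 {k = suc k} f P unique with P (f Fin.zero) in P₀
  ... | true  = ℕₚ.≤-reflexive (≡.cong suc (count-tabulate-none (f ∘ Fin.suc) P ¬P))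
    where
    ¬P : ∀ j → P (f (Fin.suc j)) ≡ false
    ¬P j with P (f (Fin.suc j)) in Pj
    ... | false = ≡.refl
    ... | true  with () ← unique Fin.zero (Fin.suc j) P₀ Pj
  ... | false = count-tabulate-≤1 (f ∘ Fin.suc) P (λ i j Pi Pj → Finₚ.suc-injective (unique (Fin.suc i) (Fin.suc j) Pi Pj))

  count-allVecs-++ : ∀ (xs : List A) m n (P : Vec A (m + n) → Bool) (P₁ : Vec A m → Bool) (P₂ : Vec A n → Bool) →
    (∀ u v → P (u V.++ v) ≡ true → P₁ u ≡ true × P₂ v ≡ true) →
    count P (allVecs xs (m + n)) ≤ count P₁ (allVecs xs m) * count P₂ (allVecs xs n)
  count-allVecs-++ xs zero n P P₁ P₂ split with P₁ [] in P₁[]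
  ... | true  = ℕₚ.≤-trans (count-mono P P₂ (allVecs xs n) (λ v Pv → proj₂ (split [] v Pv)))
                           (ℕₚ.≤-reflexive (≡.sym (ℕₚ.+-identityʳ _)))
  ... | false = ℕₚ.≤-trans (count-mono P (λ _ → false) (allVecs xs n) (λ v Pv → ≡.trans (≡.sym P₁[]) (proj₁ (split [] v Pv))))
                           (ℕₚ.≤-reflexive (count-const false (allVecs xs n)))
  count-allVecs-++ xs (suc m) n P P₁ P₂ split = begin
    count P (allVecs xs (suc (m + n)))                                        ≡⟨ count-allVecs-suc (m + n) P xs ⟩
    ∑ xs (λ x → count (λ w → P (x ∷ w)) (allVecs xs (m + n)))                ≤⟨ ∑-mono-≤ xs (λ x →
        count-allVecs-++ xs m n (λ w → P (x ∷ w)) (λ u → P₁ (x ∷ u)) P₂ (λ u v → split (x ∷ u) v)) ⟩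
    ∑ xs (λ x → count (λ u → P₁ (x ∷ u)) (allVecs xs m) * count P₂ (allVecs xs n)) ≡⟨ ∑-*ʳ xs _ _ ⟩
    ∑ xs (λ x → count (λ u → P₁ (x ∷ u)) (allVecs xs m)) * count P₂ (allVecs xs n) ≡⟨ ≡.cong (_* count P₂ (allVecs xs n))
                                                                                       (count-allVecs-suc m P₁ xs) ⟨
    count P₁ (allVecs xs (suc m)) * count P₂ (allVecs xs n)                   ∎

  count-allVecs-unique-last : ∀ k m (P : Vec (Fin k) (suc m) → Bool) →
    (∀ u i j → P (u V.∷ʳ i) ≡ true → P (u V.∷ʳ j) ≡ true → i ≡ j) →
    count P (allVecs (allFin k) (suc m)) ≤ k ^ m
  count-allVecs-unique-last k zero P unique = begin
    count P (allVecs (allFin k) 1)                              ≡⟨ count-allVecs-suc 0 P (allFin k) ⟩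
    ∑ (allFin k) (λ i → count (λ v → P (i ∷ v)) ([] ∷ []))     ≡⟨ ∑-cong (allFin k) (λ i → ≡.trans (count-∑ (λ v → P (i ∷ v)) ([] ∷ []))
                                                                                               (ℕₚ.+-identityʳ _)) ⟩
    ∑ (allFin k) (λ i → indicator (P (i ∷ [])))                 ≡⟨ count-∑ (λ i → P (i ∷ [])) (allFin k) ⟨
    count (λ i → P (i ∷ [])) (allFin k)                         ≤⟨ count-tabulate-≤1 id (λ i → P (i ∷ [])) (unique []) ⟩
    1                                                           ∎
  count-allVecs-unique-last k (suc m) P unique = begin
    count P (allVecs (allFin k) (suc (suc m)))                           ≡⟨ count-allVecs-suc (suc m) P (allFin k) ⟩
    ∑ (allFin k) (λ i → count (λ v → P (i ∷ v)) (allVecs (allFin k) (suc m))) ≤⟨ ∑-mono-≤ (allFin k) (λ i →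
        count-allVecs-unique-last k m (λ v → P (i ∷ v)) (λ u → unique (i ∷ u))) ⟩
    ∑ (allFin k) (λ _ → k ^ m)                                           ≡⟨ ∑-const (allFin k) _ ⟩
    length (allFin k) * k ^ m                                            ≡⟨ ≡.cong (_* k ^ m) (Lₚ.length-tabulate {n = k} id) ⟩
    k * k ^ m                                                            ∎

  count-anyInit : ∀ (R : A → Bool) (xs : List A) → count R xs ≤ 1 → ∀ m →
    count (anyInit R) (allVecs xs (suc m)) ≤ m * length xs ^ m
  count-anyInit R xs R≤1 zero    = ℕₚ.≤-trans (count-mono _ (λ _ → false) (allVecs xs 1) (λ { (_ ∷ []) () }))
                                             (ℕₚ.≤-reflexive (count-const false (allVecs xs 1)))
  count-anyInit {A = A} R xs R≤1 (suc m) = begin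
    count (anyInit R) (allVecs xs (suc (suc m)))                          ≡⟨ count-allVecs-suc (suc m) _ xs ⟩
    ∑ xs (λ x → count (λ w → anyInit R (x ∷ w)) V)                        ≤⟨ ∑-mono-≤ xs (λ x → ℕₚ.≤-trans
                                                                              (count-mono _ _ V (λ { (_ ∷ _) R∨ → R∨ }))
                                                                              (count-∨ (λ _ → R x) (anyInit R) V)) ⟩
    ∑ xs (λ x → count (λ _ → R x) V + count (anyInit R) V)               ≡⟨ ∑-distrib-+ xs _ _ ⟩
    ∑ xs (λ x → count (λ _ → R x) V) + ∑ xs (λ _ → count (anyInit R) V)  ≡⟨ ≡.cong₂ _+_
        (≡.trans (∑-cong xs (λ x → ≡.trans (count-const (R x) V) (≡.cong (indicator (R x) *_) (length-allVecs xs (suc m)))))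
                 (≡.trans (∑-*ʳ xs (indicator ∘ R) _) (≡.cong (_* L ^ suc m) (≡.sym (count-∑ R xs)))))
        (∑-const xs _) ⟩
    count R xs * L ^ suc m + L * count (anyInit R) V                      ≤⟨ ℕₚ.+-mono-≤ (ℕₚ.*-monoˡ-≤ (L ^ suc m) R≤1)
                                                                                        (ℕₚ.*-monoʳ-≤ L (count-anyInit R xs R≤1 m)) ⟩
    1 * L ^ suc m + L * (m * L ^ m)                                       ≡⟨ ≡.cong (1 * L ^ suc m +_) (x∙yz≈y∙xz L m (L ^ m)) ⟩
    1 * L ^ suc m + m * L ^ suc m                                         ≡⟨ ℕₚ.*-distribʳ-+ (L ^ suc m) 1 m ⟨
    suc m * L ^ suc m                                                     ∎
    where
    L : ℕ
    L = length xs
    V : List (Vec A (suc m))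
    V = allVecs xs (suc m)

  count-allBlocks : ∀ {c} {C : Set c} (xs : List A) (f : A → C) (d : C) p (P : Vec C p → Bool) B →
    count (λ u → Blocks.allBlocks d p P B (V.map f u)) (allVecs xs (B * p))
      ≤ count (λ w → P (V.map f w)) (allVecs xs p) ^ B
  count-allBlocks xs f d p P zero    = ℕₚ.≤-refl
  count-allBlocks xs f d p P (suc B) = ℕₚ.≤-trans
    (count-allVecs-++ xs p (B * p) _ (λ w → P (V.map f w)) (λ u → allBlocks P B (V.map f u)) split)
    (ℕₚ.*-monoʳ-≤ (count (λ w → P (V.map f w)) (allVecs xs p)) (count-allBlocks xs f d p P B))
    where
    open Blocks d p
    split : ∀ u v → allBlocks P (suc B) (V.map f (u V.++ v)) ≡ true →
      P (V.map f u) ≡ true × allBlocks P B (V.map f v) ≡ true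
    split u v all≡true = Boolₚ.∧-conicalˡ _ _ P∧all , Boolₚ.∧-conicalʳ (P (V.map f u)) _ P∧all
      where
      P∧all : (P (V.map f u) ∧ allBlocks P B (V.map f v)) ≡ true
      P∧all = ≡.trans (≡.sym (allBlocks-++ P B (V.map f u) (V.map f v)))
                      (≡.trans (≡.cong (allBlocks P (suc B)) (≡.sym (Vₚ.map-++ f u v))) all≡true)

module SupportSize {c ℓ q} (F : FiniteField c ℓ q) where
  open import Data.Nat using (_+_; _*_; _^_)
  open FiniteField F using (Carrier; 0#; enum; enum-injective; sym; trans)
  open Construction F using (Pval; H; nonzero; unionSize)
  open FiniteFieldProperties F using (isZero; isZero⇒≈0)
  open SupportOfP F using (Pval-support; linFormVal-root-unique; H-nonzero⇒allBlocks)
  open PolyEvaluation F using (module LinearForm)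
  open ListSum ℕₚ.+-*-semiring using (∑)
  open Counting
  open ℕₚ.≤-Reasoning

  suppSizeP : ℕ → ℕ
  suppSizeP p = count (λ w → nonzero (Pval p (V.map enum w))) (allVecs (allFin q) p)

  count-enum-zero : count (isZero ∘ enum) (allFin q) ≤ 1
  count-enum-zero = count-tabulate-≤1 id (isZero ∘ enum)
    (λ i j zeroᵢ zeroⱼ → enum-injective i j (trans (isZero⇒≈0 zeroᵢ) (sym (isZero⇒≈0 zeroⱼ))))

  module _ (m : ℕ) where
    open LinearForm m

    root : Vec Bool m → Vec (Fin q) (suc m) → Bool
    root I w = isZero (linFormVal I (V.map enum w))

    count-root : ∀ I → count (root I) (allVecs (allFin q) (suc m)) ≤ q ^ m
    count-root I = count-allVecs-unique-last q m (root I) (λ u i j rootᵢ rootⱼ →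
      enum-injective i j (linFormVal-root-unique m I (V.map enum u) (enum i) (enum j)
        (≡.subst (λ v → isZero (linFormVal I v) ≡ true) (map-∷ʳ enum u i) rootᵢ)
        (≡.subst (λ v → isZero (linFormVal I v) ≡ true) (map-∷ʳ enum u j) rootⱼ)))

  suppSizeP-≤ : 0 < q → ∀ m → suppSizeP (suc (suc m)) ≤ (suc m + 2 ^ suc m) * q ^ suc m
  suppSizeP-≤ 0<q m = begin
    count (λ w → nonzero (Pval (suc (suc m)) (V.map enum w))) V       ≤⟨ count-mono _ _ V support ⟩
    count (λ w → anyInit (isZero ∘ enum) w ∨ anyRoot w) V             ≤⟨ count-∨ _ anyRoot V ⟩
    count (anyInit (isZero ∘ enum)) V + count anyRoot V              ≤⟨ ℕₚ.+-mono-≤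
                                                                          (count-anyInit (isZero ∘ enum) (allFin q) count-enum-zero (suc m))
                                                                          (count-any (root (suc m)) (subsets (suc m)) V) ⟩
    suc m * length (allFin q) ^ suc m + ∑ (subsets (suc m)) (λ I → count (root (suc m) I) V)
                                                                     ≤⟨ ℕₚ.+-mono-≤
                                                                          (ℕₚ.≤-reflexive (≡.cong (λ k → suc m * k ^ suc m) (Lₚ.length-tabulate {n = q} id)))
                                                                          (∑-mono-≤ (subsets (suc m)) (count-root (suc m))) ⟩
    suc m * q ^ suc m + ∑ (subsets (suc m)) (λ _ → q ^ suc m)        ≡⟨ ≡.cong (suc m * q ^ suc m +_) (∑-const (subsets (suc m)) _) ⟩
    suc m * q ^ suc m + length (subsets (suc m)) * q ^ suc m          ≡⟨ ≡.cong (λ k → suc m * q ^ suc m + k * q ^ suc m)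
                                                                          (length-allVecs (false ∷ true ∷ []) (suc m)) ⟩
    suc m * q ^ suc m + 2 ^ suc m * q ^ suc m                         ≡⟨ ℕₚ.*-distribʳ-+ (q ^ suc m) (suc m) _ ⟨
    (suc m + 2 ^ suc m) * q ^ suc m                                   ∎
    where
    V : List (Vec (Fin q) (suc (suc m)))
    V = allVecs (allFin q) (suc (suc m))
    anyRoot : Vec (Fin q) (suc (suc m)) → Bool
    anyRoot w = any (λ I → root (suc m) I w) (subsets (suc m))
    support : ∀ w → nonzero (Pval (suc (suc m)) (V.map enum w)) ≡ true → (anyInit (isZero ∘ enum) w ∨ anyRoot w) ≡ true
    support w Pval≢0 = ≡.subst (λ b → (b ∨ anyRoot w) ≡ true) (anyInit-map isZero enum w)
                               (Pval-support 0<q m (V.map enum w) Pval≢0)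

  unionSize-≤ : ∀ p′ B t → unionSize (suc p′) (B * suc p′) t ≤ suppSizeP (suc p′) ^ B * q ^ t
  unionSize-≤ p′ B t = begin
    count inUnion (allVecs (allFin q) (B * p + t))
      ≤⟨ count-allVecs-++ (allFin q) (B * p) t inUnion (λ u → allBlocks P B (V.map enum u)) (λ _ → true) split ⟩
    count (λ u → allBlocks P B (V.map enum u)) (allVecs (allFin q) (B * p)) * count (λ _ → true) (allVecs (allFin q) t)
      ≤⟨ ℕₚ.*-mono-≤ (count-allBlocks (allFin q) enum 0# p P B) (ℕₚ.≤-reflexive (count-true (allVecs (allFin q) t))) ⟩
    suppSizeP p ^ B * length (allVecs (allFin q) t)
      ≡⟨ ≡.cong (suppSizeP p ^ B *_) (≡.trans (length-allVecs (allFin q) t) (≡.cong (_^ t) (Lₚ.length-tabulate {n = q} id))) ⟩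
    suppSizeP p ^ B * q ^ t ∎
    where
    p : ℕ
    p = suc p′
    open Blocks 0# p
    P : Vec Carrier p → Bool
    P = nonzero ∘ Pval p
    inUnion : Vec (Fin q) (B * p + t) → Bool
    inUnion idx = any (λ e → nonzero (H p (B * p) t e (V.map enum idx))) (allVecs (allFin q) t)
    split : ∀ u v → inUnion (u V.++ v) ≡ true → allBlocks P B (V.map enum u) ≡ true × true ≡ true
    split u v inUnion≡true with Any.satisfied (Anyₚ.any⁻ _ (allVecs (allFin q) t) (Equivalence.from Boolₚ.T-≡ inUnion≡true))
    ... | e , H≢0 = ≡.trans (≡.sym (allBlocks-++ˡ P B (V.map enum u) (V.map enum v)))
                      (≡.trans (≡.cong (allBlocks P B) (≡.sym (Vₚ.map-++ enum u v)))
                               (H-nonzero⇒allBlocks p′ B t e (V.map enum (u V.++ v)) (Equivalence.to Boolₚ.T-≡ H≢0)))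
                  , ≡.refl

module Arithmetic where
  open import Data.Nat using (_+_; _*_; _^_)
  open import Data.Nat.Tactic.RingSolver using (solve-∀)
  open import Algebra.Properties.CommutativeSemigroup ℕₚ.*-commutativeSemigroup using (interchange)
  open ℕₚ.≤-Reasoning

  ^-distribʳ-* : ∀ a b n → (a * b) ^ n ≡ a ^ n * b ^ n
  ^-distribʳ-* a b zero    = ≡.refl
  ^-distribʳ-* a b (suc n) = ≡.trans (≡.cong (a * b *_) (^-distribʳ-* a b n)) (interchange a b (a ^ n) (b ^ n))

  m+2^m≤3^m : ∀ m → m + 2 ^ m ≤ 3 ^ m
  m+2^m≤3^m zero    = ℕₚ.≤-refl
  m+2^m≤3^m (suc m) = begin
    suc m + 2 * 2 ^ m           ≡⟨ regroup m (2 ^ m) ⟩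
    (m + 2 ^ m) + (1 + 2 ^ m)   ≤⟨ ℕₚ.+-mono-≤ (m+2^m≤3^m m) (ℕₚ.+-mono-≤ (ℕₚ.m^n>0 3 m) (ℕₚ.^-monoˡ-≤ m (s≤s (s≤s z≤n)))) ⟩
    3 ^ m + (3 ^ m + 3 ^ m)     ≡⟨ triple (3 ^ m) ⟩
    3 * 3 ^ m                   ∎
    where
    regroup : ∀ m x → suc m + 2 * x ≡ (m + x) + (1 + x)
    regroup = solve-∀
    triple : ∀ x → x + (x + x) ≡ 3 * x
    triple = solve-∀

  [m+2^m]q^m≤[3q]^m : ∀ m q → (m + 2 ^ m) * q ^ m ≤ (3 * q) ^ m
  [m+2^m]q^m≤[3q]^m m q = ℕₚ.≤-trans (ℕₚ.*-monoˡ-≤ (q ^ m) (m+2^m≤3^m m)) (ℕₚ.≤-reflexive (≡.sym (^-distribʳ-* 3 q m)))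

  ^-raise-bound : ∀ {U} a .{{_ : ℕ.NonZero a}} {e} q t D → U ≤ a ^ e * q ^ t → e * q ≤ D → U ^ q ≤ a ^ D * q ^ (t * q)
  ^-raise-bound {U} a {e} q t D U≤ eq≤D = begin
    U ^ q                          ≤⟨ ℕₚ.^-monoˡ-≤ q U≤ ⟩
    (a ^ e * q ^ t) ^ q            ≡⟨ ^-distribʳ-* (a ^ e) (q ^ t) q ⟩
    (a ^ e) ^ q * (q ^ t) ^ q      ≡⟨ ≡.cong₂ _*_ (ℕₚ.^-*-assoc a e q) (ℕₚ.^-*-assoc q t q) ⟩
    a ^ (e * q) * q ^ (t * q)      ≤⟨ ℕₚ.*-monoˡ-≤ (q ^ (t * q)) (ℕₚ.^-monoʳ-≤ a eq≤D) ⟩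
    a ^ D * q ^ (t * q)            ∎

  block-exponent : ∀ m B k → m * B * (suc m ^ suc k) ≡ B * suc m * (suc m ^ suc k ∸ suc m ^ k)
  block-exponent m B k = begin-equality
    m * B * (suc m * X)                  ≡⟨ rearrange m B X ⟩
    B * suc m * (m * X)                  ≡⟨ ≡.cong (B * suc m *_) (ℕₚ.m+n∸m≡n X (m * X)) ⟨
    B * suc m * (suc m * X ∸ X)          ∎
    where
    X : ℕ
    X = suc m ^ k
    rearrange : ∀ m B X → m * B * (suc m * X) ≡ B * suc m * (m * X)
    rearrange = solve-∀

open import Data.Nat using (_+_; _*_; _^_)
open import Data.Nat.Divisibility using (_∣_; divides)
open import Data.Nat.Primality using (Prime)
open Arithmetic

lemma3p7 : ∀ {c ℓ} (p k : ℕ) → Prime p → (F : FiniteField c ℓ (p ^ k)) →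
    (d s r t : ℕ) → 1 ≤ d → p ∣ s → 0 < r →
    r ≤ p * (p ^ k ∸ p ^ (k ∸ 1)) →
    d + 1 ≡ s * (p ^ k ∸ p ^ (k ∸ 1)) + r → 1 ≤ t →
    Construction.unionSize F p s t ^ (p ^ k)
      ≤ (3 * p ^ k) ^ (d + 1) * (p ^ k) ^ (t * p ^ k)
lemma3p7 zero          _ () _
lemma3p7 (suc zero)    _ () _
lemma3p7 (suc (suc m)) zero _ _ _ _ r _ _ _ 0<r r≤0 _ _ =
  ⊥-elim (ℕₚ.<-irrefl ≡.refl (ℕₚ.<-≤-trans 0<r (≡.subst (r ≤_) (ℕₚ.*-zeroʳ (suc (suc m))) r≤0)))
lemma3p7 (suc (suc m)) (suc k) _ F d .(B * suc (suc m)) r t _ (divides B ≡.refl) _ _ d+1≡ _ =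
  ^-raise-bound (3 * q) {{ℕ.>-nonZero (ℕₚ.*-monoʳ-< 3 0<q)}} {suc m * B} q t (d + 1) union≤ exponent≤
  where
  open SupportSize F
  open ℕₚ.≤-Reasoning
  p q : ℕ
  p = suc (suc m)
  q = p ^ suc k
  0<q : 0 < q
  0<q = ℕₚ.m^n>0 p (suc k)
  union≤ : Construction.unionSize F p (B * p) t ≤ (3 * q) ^ (suc m * B) * q ^ t
  union≤ = begin
    Construction.unionSize F p (B * p) t                                         ≤⟨ unionSize-≤ (suc m) B t ⟩
    suppSizeP p ^ B * q ^ t                                                       ≤⟨ ℕₚ.*-monoˡ-≤ (q ^ t) (ℕₚ.^-monoˡ-≤ B
                                                                                      (ℕₚ.≤-trans (suppSizeP-≤ 0<q m) ([m+2^m]q^m≤[3q]^m (suc m) q))) ⟩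
    ((3 * q) ^ suc m) ^ B * q ^ t                                                 ≡⟨ ≡.cong (_* q ^ t) (ℕₚ.^-*-assoc (3 * q) (suc m) B) ⟩
    (3 * q) ^ (suc m * B) * q ^ t                                                 ∎
  exponent≤ : suc m * B * q ≤ d + 1
  exponent≤ = begin
    suc m * B * q                  ≡⟨ block-exponent (suc m) B k ⟩
    B * p * (q ∸ p ^ k)            ≤⟨ ℕₚ.m≤m+n _ r ⟩
    B * p * (q ∸ p ^ k) + r        ≡⟨ d+1≡ ⟨
    d + 1                          ∎
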